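{- Let $$S(x)=\sum_{n_1,n_2,n_3\ge 0}\frac{(-1)^{n_3}x^{n_1+2n_2+3n_3}\,q^{4\binom{n_1}{2}+4\binom{n_2}{2}+18\binom{n_3}{2}+2n_1n_2+6n_2n_3+6n_3n_1+ n_1+2 n_2+9n_3}}{(q^2;q^2)_{n_1}(q^2;q^2)_{n_2}(q^6;q^6)_{n_3}}.$$ Then \begin{align*} 0&=S(x)-\big[x^2q^2(1+q^2+q^4)+1\big]S(xq^2)+\big[x^4q^{10}(1+q^2+q^4)+x^2q^6-xq\big]S(xq^4)-\big[x^6q^{24}-x^3q^9\big]S(xq^6). \end{align*}
   Context: The $q$-Pochhammer symbol is $(A;q)_n=\prod_{k=0}^{n-1}(1-Aq^k)$. -}

module Defs where

open import Data.Nat as ℕ using (ℕ; zero; suc; _≤ᵇ_; _≡ᵇ_; _∸_)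
open import Data.Nat.Combinatorics using (_C_)
open import Data.Nat.Divisibility using (_∣?_)
open import Data.Integer using (ℤ; +_; -_; _+_; _*_; _^_; -1ℤ; 0ℤ; 1ℤ)
open import Data.Bool using (Bool; if_then_else_; _∧_)
open import Relation.Nullary.Decidable using (⌊_⌋)

-- Formal power series in q with integer coefficients: n ↦ [q^n] f
PS : Set
PS = ℕ → ℤ

sumTo : ℕ → (ℕ → ℤ) → ℤ
sumTo zero    f = f zero
sumTo (suc n) f = sumTo n f + f (suc n)

oneP : PS
oneP zero    = 1ℤ
oneP (suc _) = 0ℤ

_⊛_ : PS → PS → PS
(f ⊛ g) n = sumTo n (λ i → f i * g (n ∸ i))

shiftP : ℕ → PS → PS
shiftP k f n = if k ≤ᵇ n then f (n ∸ k) else 0ℤ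

-- 1/(1 - q^m) = Σ_k q^{mk}   (used only for m ≥ 1)
geom : ℕ → PS
geom m n = if ⌊ m ∣? n ⌋ then 1ℤ else 0ℤ

-- 1/(q^m;q^m)_n = ∏_{j=1}^{n} 1/(1 - q^{m j})   as a formal power series in q
invPoch : ℕ → ℕ → PS
invPoch m zero    = oneP
invPoch m (suc n) = invPoch m n ⊛ geom (m ℕ.* suc n)

expo : ℕ → ℕ → ℕ → ℕ
expo n₁ n₂ n₃ =
  4 ℕ.* (n₁ C 2) ℕ.+ 4 ℕ.* (n₂ C 2) ℕ.+ 18 ℕ.* (n₃ C 2)
  ℕ.+ 2 ℕ.* n₁ ℕ.* n₂ ℕ.+ 6 ℕ.* n₂ ℕ.* n₃ ℕ.+ 6 ℕ.* n₃ ℕ.* n₁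
  ℕ.+ n₁ ℕ.+ 2 ℕ.* n₂ ℕ.+ 9 ℕ.* n₃

-- the q-series multiplying x^{n₁+2n₂+3n₃} in S(x)
term : ℕ → ℕ → ℕ → PS
term n₁ n₂ n₃ b =
  (-1ℤ ^ n₃) * shiftP (expo n₁ n₂ n₃) ((invPoch 2 n₁ ⊛ invPoch 2 n₂) ⊛ invPoch 6 n₃) b

-- Formal power series in x and q: S a b = [x^a q^b] S(x)
Ser : Set
Ser = ℕ → ℕ → ℤ

S : Ser
S a b = sumTo a λ n₁ → sumTo a λ n₂ → sumTo a λ n₃ →
  if (n₁ ℕ.+ 2 ℕ.* n₂ ℕ.+ 3 ℕ.* n₃) ≡ᵇ a then term n₁ n₂ n₃ b else 0ℤ

-- F(x q^k)
subst : ℕ → Ser → Ser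
subst k F a b = if (k ℕ.* a) ≤ᵇ b then F a (b ∸ k ℕ.* a) else 0ℤ

mono : ℤ → ℕ → ℕ → Ser → Ser
mono c i j F a b = if (i ≤ᵇ a) ∧ (j ≤ᵇ b) then c * F (a ∸ i) (b ∸ j) else 0ℤ

-- c · x^i q^j · S(x q^k)
T : ℤ → ℕ → ℕ → ℕ → Ser
T c i j k = mono c i j (subst k S)

R : Ser
R a b =
    T 1ℤ 0 0 0 a b
  + T -1ℤ 2 2 2 a b + T -1ℤ 2 4 2 a b + T -1ℤ 2 6 2 a b + T -1ℤ 0 0 2 a b
  + T 1ℤ 4 10 4 a b + T 1ℤ 4 12 4 a b + T 1ℤ 4 14 4 a b + T 1ℤ 2 6 4 a b + T -1ℤ 1 1 4 a b
  + T -1ℤ 6 24 6 a b + T 1ℤ 3 9 6 a b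

-- Write S(x) = Σₙ x^|n| (-1)^n₃ q^e(n) P(n) over n ∈ ℕ³, with |n| = n₁ + 2n₂ + 3n₃ and
-- P(n) = 1/((q²;q²)_n₁ (q²;q²)_n₂ (q⁶;q⁶)_n₃). For each term c x^i q^j S(x q^k) of the equation,
-- choose κ ∈ ℕ³ with |κ| = i and move the summand m of S to n = κ + m. Since
-- 1/(q^s;q^s)_m = (1 - q^(s(m+1))) ⋯ (1 - q^(s(m+κ))) / (q^s;q^s)_(m+κ) and e(κ + m) - e(m) is
-- linear in m, the coefficient of x^a becomes Σ_{|n| = a} (-1)^n₃ q^e(n) P(n) M(n) for a
-- polynomial M in q, q^(2n₁), q^(2n₂), q^(6n₃); the same factors make M(n) vanish when n ≱ κ,
-- so the sum may run over the whole simplex |n| = a. The twelve polynomials M add up to 0.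

module Submission where

open import Defs
open import Data.Nat using (ℕ)
open import Data.Integer using (0ℤ)
open import Relation.Binary.PropositionalEquality using (_≡_)

open import Data.Bool using (true; false; if_then_else_)
open import Data.Bool.Properties using (T-≡)
open import Data.Empty using (⊥-elim)
open import Data.Integer as ℤ using (ℤ; _+_; _*_; _-_; -_; 1ℤ; -1ℤ)
import Data.Integer.Properties as ℤP
open import Data.Integer.Tactic.RingSolver using (solve-∀)
open import Data.List using (List; []; _∷_; _++_; map; foldr; concatMap)
open import Data.List.Properties using (map-cong)
open import Data.Nat as ℕ using (zero; suc; _≤ᵇ_; _≡ᵇ_; _∸_; _≤_; _<_; z≤n; s≤s)
open import Data.Nat.Combinatorics using (_C_; nCk+nC[k+1]≡[n+1]C[k+1]; nC1≡n)
open import Data.Nat.Divisibility using (_∣?_; _∣0; ∣m+n∣m⇒∣n; ∣m∣n⇒∣m+n; ∣⇒≤; n∣n)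
import Data.Nat.Properties as ℕP
import Data.Nat.Tactic.RingSolver as NS
open import Data.Product using (_×_; _,_)
open import Data.Product.Properties using (≡-dec)
open import Data.Sum using (_⊎_; inj₁; inj₂) renaming (map to ⊎-map)
open import Function.Bundles using (Equivalence)
open import Relation.Binary.Definitions using (DecidableEquality)
open import Relation.Binary.PropositionalEquality
  using (refl; sym; trans; cong; cong₂; _≗_; module ≡-Reasoning)
open import Relation.Nullary using (yes; no)

open ≡-Reasoning

data Split (k n : ℕ) : Set where
  above : ∀ r → n ≡ k ℕ.+ r → Split k n
  below : n < k → Split k n

split : ∀ k n → Split k n
split zero    n       = above n refl
split (suc k) zero    = below (s≤s z≤n)
split (suc k) (suc n) with split k n
... | above r eq = above r (cong suc eq)
... | below n<k  = below (s≤s n<k)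

≤ᵇ-+ : ∀ k r → (k ≤ᵇ k ℕ.+ r) ≡ true
≤ᵇ-+ zero          r = refl
≤ᵇ-+ (suc zero)    r = refl
≤ᵇ-+ (suc (suc k)) r = ≤ᵇ-+ (suc k) r

≤ᵇ-< : ∀ {k n} → n < k → (k ≤ᵇ n) ≡ false
≤ᵇ-< {suc zero}    {zero}  _         = refl
≤ᵇ-< {suc zero}    {suc n} (s≤s ())
≤ᵇ-< {suc (suc k)} {zero}  _         = refl
≤ᵇ-< {suc (suc k)} {suc n} (s≤s n<k) = ≤ᵇ-< n<k

≡ᵇ-+ : ∀ i x y → (i ℕ.+ x ≡ᵇ i ℕ.+ y) ≡ (x ≡ᵇ y)
≡ᵇ-+ zero    x y = refl
≡ᵇ-+ (suc i) x y = ≡ᵇ-+ i x y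

≡ᵇ-> : ∀ x y → y < x → (x ≡ᵇ y) ≡ false
≡ᵇ-> (suc x) zero    _         = refl
≡ᵇ-> (suc x) (suc y) (s≤s y<x) = ≡ᵇ-> x y y<x

if-zero : ∀ b → (if b then 0ℤ else 0ℤ) ≡ 0ℤ
if-zero true  = refl
if-zero false = refl

sumTo-cong : ∀ N {f g : ℕ → ℤ} → (∀ i → i ≤ N → f i ≡ g i) → sumTo N f ≡ sumTo N g
sumTo-cong zero    f≡g = f≡g 0 z≤n
sumTo-cong (suc N) f≡g =
  cong₂ _+_ (sumTo-cong N λ i i≤N → f≡g i (ℕP.m≤n⇒m≤1+n i≤N)) (f≡g (suc N) ℕP.≤-refl)

sumTo-congᶠ : ∀ N {f g : ℕ → ℤ} → f ≗ g → sumTo N f ≡ sumTo N g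
sumTo-congᶠ N f≗g = sumTo-cong N λ i _ → f≗g i

sumTo-zero : ∀ N {f : ℕ → ℤ} → (∀ i → i ≤ N → f i ≡ 0ℤ) → sumTo N f ≡ 0ℤ
sumTo-zero zero    f≡0 = f≡0 0 z≤n
sumTo-zero (suc N) f≡0 =
  cong₂ _+_ (sumTo-zero N λ i i≤N → f≡0 i (ℕP.m≤n⇒m≤1+n i≤N)) (f≡0 (suc N) ℕP.≤-refl)

sumTo-+ : ∀ N (f g : ℕ → ℤ) → sumTo N (λ i → f i + g i) ≡ sumTo N f + sumTo N g
sumTo-+ zero    f g = refl
sumTo-+ (suc N) f g = trans (cong (_+ (f (suc N) + g (suc N))) (sumTo-+ N f g))
                              (interchange (sumTo N f) (sumTo N g) (f (suc N)) (g (suc N)))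
  where
  interchange : ∀ a b c d → a + b + (c + d) ≡ a + c + (b + d)
  interchange = solve-∀

sumTo-* : ∀ N c (f : ℕ → ℤ) → sumTo N (λ i → c * f i) ≡ c * sumTo N f
sumTo-* zero    c f = refl
sumTo-* (suc N) c f =
  trans (cong (_+ c * f (suc N)) (sumTo-* N c f)) (sym (ℤP.*-distribˡ-+ c (sumTo N f) (f (suc N))))

sumTo-tail : ∀ N M (f : ℕ → ℤ) → M ≤ N → (∀ i → M < i → i ≤ N → f i ≡ 0ℤ) → sumTo N f ≡ sumTo M f
sumTo-tail N M f M≤N f≡0 with ℕP.m≤n⇒m<n∨m≡n M≤N
sumTo-tail N       M f M≤N f≡0 | inj₂ refl = refl
sumTo-tail (suc N) M f M≤N f≡0 | inj₁ (s≤s M≤N′) = begin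
  sumTo N f + f (suc N) ≡⟨ cong (sumTo N f +_) (f≡0 (suc N) (s≤s M≤N′) ℕP.≤-refl) ⟩
  sumTo N f + 0ℤ        ≡⟨ ℤP.+-identityʳ (sumTo N f) ⟩
  sumTo N f             ≡⟨ sumTo-tail N M f M≤N′ (λ i M<i i≤N → f≡0 i M<i (ℕP.m≤n⇒m≤1+n i≤N)) ⟩
  sumTo M f             ∎

sumTo-last : ∀ d (f : ℕ → ℤ) → (∀ i → i < d → f i ≡ 0ℤ) → sumTo d f ≡ f d
sumTo-last zero    f f≡0 = refl
sumTo-last (suc d) f f≡0 = begin
  sumTo d f + f (suc d) ≡⟨ cong (_+ f (suc d)) (sumTo-last d f (λ i i<d → f≡0 i (ℕP.m≤n⇒m≤1+n i<d))) ⟩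
  f d + f (suc d)       ≡⟨ cong (_+ f (suc d)) (f≡0 d ℕP.≤-refl) ⟩
  0ℤ + f (suc d)        ≡⟨ ℤP.+-identityˡ (f (suc d)) ⟩
  f (suc d)             ∎

shiftP-above : ∀ k r (f : PS) → shiftP k f (k ℕ.+ r) ≡ f r
shiftP-above k r f rewrite ≤ᵇ-+ k r = cong f (ℕP.m+n∸m≡n k r)

shiftP-below : ∀ {k n} (f : PS) → n < k → shiftP k f n ≡ 0ℤ
shiftP-below {k} {n} f n<k rewrite ≤ᵇ-< n<k = refl

shiftP-cong : ∀ k {f g : PS} → f ≗ g → shiftP k f ≗ shiftP k g
shiftP-cong k {f} {g} f≗g n with split k n
... | above r refl = trans (shiftP-above k r f) (trans (f≗g r) (sym (shiftP-above k r g)))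
... | below n<k    = trans (shiftP-below f n<k) (sym (shiftP-below g n<k))

shiftP-shiftP : ∀ s t (f : PS) → shiftP s (shiftP t f) ≗ shiftP (t ℕ.+ s) f
shiftP-shiftP s t f n with split s n
... | below n<s = trans (shiftP-below (shiftP t f) n<s) (sym (shiftP-below f (ℕP.<-≤-trans n<s (ℕP.m≤n+m s t))))
... | above r refl with split t r
...   | above r′ refl = begin
  shiftP s (shiftP t f) (s ℕ.+ (t ℕ.+ r′)) ≡⟨ shiftP-above s _ (shiftP t f) ⟩
  shiftP t f (t ℕ.+ r′)                    ≡⟨ shiftP-above t r′ f ⟩
  f r′                                     ≡⟨ shiftP-above (t ℕ.+ s) r′ f ⟨
  shiftP (t ℕ.+ s) f (t ℕ.+ s ℕ.+ r′)      ≡⟨ cong (shiftP (t ℕ.+ s) f) (reassoc s t r′) ⟩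
  shiftP (t ℕ.+ s) f (s ℕ.+ (t ℕ.+ r′))    ∎
  where
  reassoc : ∀ s t r → t ℕ.+ s ℕ.+ r ≡ s ℕ.+ (t ℕ.+ r)
  reassoc = NS.solve-∀
...   | below r<t = trans (shiftP-above s r (shiftP t f)) (trans (shiftP-below f r<t)
                      (sym (shiftP-below f (ℕP.<-≤-trans (ℕP.+-monoʳ-< s r<t) (ℕP.≤-reflexive (ℕP.+-comm s t))))))

shiftP-comm : ∀ s t (f : PS) → shiftP s (shiftP t f) ≗ shiftP t (shiftP s f)
shiftP-comm s t f n = begin
  shiftP s (shiftP t f) n  ≡⟨ shiftP-shiftP s t f n ⟩
  shiftP (t ℕ.+ s) f n     ≡⟨ cong (λ k → shiftP k f n) (ℕP.+-comm t s) ⟩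
  shiftP (s ℕ.+ t) f n     ≡⟨ shiftP-shiftP t s f n ⟨
  shiftP t (shiftP s f) n  ∎

shiftP-zero : ∀ k n {f : PS} → f ≗ (λ _ → 0ℤ) → shiftP k f n ≡ 0ℤ
shiftP-zero k n f≗0 = trans (shiftP-cong k f≗0 n) (if-zero (k ≤ᵇ n))

shiftP-map : ∀ s (φ : ℤ → ℤ) → φ 0ℤ ≡ 0ℤ → ∀ (f : PS) → shiftP s (λ b → φ (f b)) ≗ λ b → φ (shiftP s f b)
shiftP-map s φ φ0 f n with s ≤ᵇ n
... | true  = refl
... | false = sym φ0

shiftP-map₂ : ∀ s (_∙_ : ℤ → ℤ → ℤ) → 0ℤ ∙ 0ℤ ≡ 0ℤ →
  ∀ (f g : PS) → shiftP s (λ b → f b ∙ g b) ≗ λ b → shiftP s f b ∙ shiftP s g b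
shiftP-map₂ s _∙_ 0∙0 f g n with s ≤ᵇ n
... | true  = refl
... | false = sym 0∙0

sumTo-shiftP : ∀ M d (f : ℕ → ℤ) → sumTo (M ℕ.+ d) (shiftP d f) ≡ sumTo M f
sumTo-shiftP zero d f = begin
  sumTo d (shiftP d f)  ≡⟨ sumTo-last d _ (λ i i<d → shiftP-below f i<d) ⟩
  shiftP d f d          ≡⟨ cong (shiftP d f) (ℕP.+-identityʳ d) ⟨
  shiftP d f (d ℕ.+ 0)  ≡⟨ shiftP-above d 0 f ⟩
  f 0                   ∎
sumTo-shiftP (suc M) d f =
  cong₂ _+_ (sumTo-shiftP M d f)
            (trans (cong (shiftP d f) (ℕP.+-comm (suc M) d)) (shiftP-above d (suc M) f))

⊛-cong : ∀ {f f′ g g′ : PS} → f ≗ f′ → g ≗ g′ → (f ⊛ g) ≗ (f′ ⊛ g′)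
⊛-cong f≗f′ g≗g′ n = sumTo-congᶠ n λ i → cong₂ _*_ (f≗f′ i) (g≗g′ (n ∸ i))

⊛-congˡ : ∀ {f f′ : PS} (g : PS) → f ≗ f′ → (f ⊛ g) ≗ (f′ ⊛ g)
⊛-congˡ g f≗f′ = ⊛-cong {g = g} {g′ = g} f≗f′ λ _ → refl

⊛-linearˡ : ∀ c (f f′ g : PS) → ((λ b → c * f b + f′ b) ⊛ g) ≗ λ n → c * (f ⊛ g) n + (f′ ⊛ g) n
⊛-linearˡ c f f′ g n = begin
  sumTo n (λ i → (c * f i + f′ i) * g (n ∸ i))
    ≡⟨ sumTo-congᶠ n (λ i → distrib c (f i) (f′ i) (g (n ∸ i))) ⟩
  sumTo n (λ i → c * (f i * g (n ∸ i)) + f′ i * g (n ∸ i))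
    ≡⟨ sumTo-+ n _ _ ⟩
  sumTo n (λ i → c * (f i * g (n ∸ i))) + (f′ ⊛ g) n
    ≡⟨ cong (_+ (f′ ⊛ g) n) (sumTo-* n c _) ⟩
  c * (f ⊛ g) n + (f′ ⊛ g) n ∎
  where
  distrib : ∀ c x x′ y → (c * x + x′) * y ≡ c * (x * y) + x′ * y
  distrib = solve-∀

⊛-linearʳ : ∀ c (f g g′ : PS) → (f ⊛ (λ b → c * g b + g′ b)) ≗ λ n → c * (f ⊛ g) n + (f ⊛ g′) n
⊛-linearʳ c f g g′ n = begin
  sumTo n (λ i → f i * (c * g (n ∸ i) + g′ (n ∸ i)))
    ≡⟨ sumTo-congᶠ n (λ i → distrib c (f i) (g (n ∸ i)) (g′ (n ∸ i))) ⟩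
  sumTo n (λ i → c * (f i * g (n ∸ i)) + f i * g′ (n ∸ i))
    ≡⟨ sumTo-+ n _ _ ⟩
  sumTo n (λ i → c * (f i * g (n ∸ i))) + (f ⊛ g′) n
    ≡⟨ cong (_+ (f ⊛ g′) n) (sumTo-* n c _) ⟩
  c * (f ⊛ g) n + (f ⊛ g′) n ∎
  where
  distrib : ∀ c x y y′ → x * (c * y + y′) ≡ c * (x * y) + x * y′
  distrib = solve-∀

⊛-zeroˡ : ∀ (g : PS) → ((λ _ → 0ℤ) ⊛ g) ≗ λ _ → 0ℤ
⊛-zeroˡ g n = sumTo-zero n λ i _ → ℤP.*-zeroˡ (g (n ∸ i))

⊛-zeroʳ : ∀ (f : PS) → (f ⊛ (λ _ → 0ℤ)) ≗ λ _ → 0ℤ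
⊛-zeroʳ f n = sumTo-zero n λ i _ → ℤP.*-zeroʳ (f i)

shiftP-⊛ˡ : ∀ k (f g : PS) → (shiftP k f ⊛ g) ≗ shiftP k (f ⊛ g)
shiftP-⊛ˡ k f g n with split k n
... | below n<k = trans (sumTo-zero n λ i i≤n → vanish (ℕP.≤-<-trans i≤n n<k)) (sym (shiftP-below (f ⊛ g) n<k))
  where
  vanish : ∀ {i} → i < k → shiftP k f i * g (n ∸ i) ≡ 0ℤ
  vanish {i} i<k = trans (cong (_* g (n ∸ i)) (shiftP-below f i<k)) (ℤP.*-zeroˡ (g (n ∸ i)))
... | above r refl = begin
  sumTo (k ℕ.+ r) h                      ≡⟨ cong (λ N → sumTo N h) (ℕP.+-comm k r) ⟩
  sumTo (r ℕ.+ k) h                      ≡⟨ sumTo-congᶠ (r ℕ.+ k) summand ⟩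
  sumTo (r ℕ.+ k) (shiftP k fg)          ≡⟨ sumTo-shiftP r k fg ⟩
  (f ⊛ g) r                              ≡⟨ shiftP-above k r (f ⊛ g) ⟨
  shiftP k (f ⊛ g) (k ℕ.+ r)             ∎
  where
  h fg : ℕ → ℤ
  h i = shiftP k f i * g (k ℕ.+ r ∸ i)
  fg j = f j * g (r ∸ j)
  summand : h ≗ shiftP k fg
  summand i with split k i
  ... | above j refl = begin
    shiftP k f (k ℕ.+ j) * g (k ℕ.+ r ∸ (k ℕ.+ j))
      ≡⟨ cong₂ _*_ (shiftP-above k j f) (cong g (ℕP.[m+n]∸[m+o]≡n∸o k r j)) ⟩
    fg j
      ≡⟨ shiftP-above k j fg ⟨
    shiftP k fg (k ℕ.+ j) ∎
  ... | below i<k = trans (cong (_* g (k ℕ.+ r ∸ i)) (shiftP-below f i<k))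
                          (trans (ℤP.*-zeroˡ (g (k ℕ.+ r ∸ i))) (sym (shiftP-below fg i<k)))

shiftP-⊛ʳ : ∀ k (f g : PS) → (f ⊛ shiftP k g) ≗ shiftP k (f ⊛ g)
shiftP-⊛ʳ k f g n with split k n
... | below n<k =
  trans (sumTo-zero n λ i _ → vanish (ℕP.≤-<-trans (ℕP.m∸n≤m n i) n<k)) (sym (shiftP-below (f ⊛ g) n<k))
  where
  vanish : ∀ {i} → n ∸ i < k → f i * shiftP k g (n ∸ i) ≡ 0ℤ
  vanish {i} lt = trans (cong (f i *_) (shiftP-below g lt)) (ℤP.*-zeroʳ (f i))
... | above r refl = begin
  sumTo (k ℕ.+ r) (λ i → f i * shiftP k g (k ℕ.+ r ∸ i))
    ≡⟨ sumTo-tail (k ℕ.+ r) r _ (ℕP.m≤n+m r k) late ⟩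
  sumTo r (λ i → f i * shiftP k g (k ℕ.+ r ∸ i))
    ≡⟨ sumTo-cong r early ⟩
  (f ⊛ g) r
    ≡⟨ shiftP-above k r (f ⊛ g) ⟨
  shiftP k (f ⊛ g) (k ℕ.+ r) ∎
  where
  late : ∀ i → r < i → i ≤ k ℕ.+ r → f i * shiftP k g (k ℕ.+ r ∸ i) ≡ 0ℤ
  late i r<i i≤k+r = trans (cong (f i *_) (shiftP-below g lt)) (ℤP.*-zeroʳ (f i))
    where
    lt : k ℕ.+ r ∸ i < k
    lt = ℕP.<-≤-trans (ℕP.∸-monoʳ-< r<i i≤k+r) (ℕP.≤-reflexive (ℕP.m+n∸n≡m k r))
  early : ∀ i → i ≤ r → f i * shiftP k g (k ℕ.+ r ∸ i) ≡ f i * g (r ∸ i)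
  early i i≤r = cong (f i *_) (trans (cong (shiftP k g) (ℕP.+-∸-assoc k i≤r)) (shiftP-above k (r ∸ i) g))

shiftP-⊛ : ∀ s t (f g : PS) → shiftP (s ℕ.+ t) (f ⊛ g) ≗ (shiftP s f ⊛ shiftP t g)
shiftP-⊛ s t f g n = begin
  shiftP (s ℕ.+ t) (f ⊛ g) n         ≡⟨ shiftP-shiftP t s (f ⊛ g) n ⟨
  shiftP t (shiftP s (f ⊛ g)) n      ≡⟨ shiftP-cong t (λ m → sym (shiftP-⊛ˡ s f g m)) n ⟩
  shiftP t (shiftP s f ⊛ g) n        ≡⟨ shiftP-⊛ʳ t (shiftP s f) g n ⟨
  (shiftP s f ⊛ shiftP t g) n        ∎

-- The geometric series 1/(1 - q^k)

geom-zero : ∀ k → geom k 0 ≡ 1ℤ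
geom-zero k with k ∣? 0
... | yes _   = refl
... | no k∤0 = ⊥-elim (k∤0 (k ∣0))

geom-small : ∀ k m → 0 < m → m < k → geom k m ≡ 0ℤ
geom-small k (suc m) _ m<k with k ∣? suc m
... | yes k∣m = ⊥-elim (ℕP.<⇒≱ m<k (∣⇒≤ k∣m))
... | no _    = refl

geom-periodic : ∀ k m → geom k (k ℕ.+ m) ≡ geom k m
geom-periodic k m with k ∣? (k ℕ.+ m) | k ∣? m
... | yes _   | yes _   = refl
... | no _    | no _    = refl
... | yes k∣k+m | no k∤m  = ⊥-elim (k∤m (∣m+n∣m⇒∣n k∣k+m n∣n))
... | no k∤k+m  | yes k∣m = ⊥-elim (k∤k+m (∣m∣n⇒∣m+n n∣n k∣m))

geom-diagonal : ∀ k (f : PS) m → f m * geom k (m ∸ m) ≡ f m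
geom-diagonal k f m = trans (cong (λ z → f m * geom k z) (ℕP.n∸n≡0 m))
                            (trans (cong (f m *_) (geom-zero k)) (ℤP.*-identityʳ (f m)))

geom-inverse : ∀ k (f : PS) → let F = f ⊛ geom (suc k) in (λ n → F n - shiftP (suc k) F n) ≗ f
geom-inverse k f n with split (suc k) n
... | below n<K = begin
  F n - shiftP K F n ≡⟨ cong (λ z → F n - z) (shiftP-below F n<K) ⟩
  F n + - 0ℤ        ≡⟨ ℤP.+-identityʳ (F n) ⟩
  F n               ≡⟨ sumTo-last n (λ i → f i * geom K (n ∸ i)) (λ i i<n → off-diagonal i i<n) ⟩
  f n * geom K (n ∸ n) ≡⟨ geom-diagonal K f n ⟩
  f n               ∎
  where
  K = suc k
  F = f ⊛ geom K
  off-diagonal : ∀ i → i < n → f i * geom K (n ∸ i) ≡ 0ℤ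
  off-diagonal i i<n =
    trans (cong (f i *_) (geom-small K (n ∸ i) (ℕP.m<n⇒0<n∸m i<n) (ℕP.≤-<-trans (ℕP.m∸n≤m n i) n<K)))
          (ℤP.*-zeroʳ (f i))
... | above r refl = begin
  F (K ℕ.+ r) - shiftP K F (K ℕ.+ r)          ≡⟨ cong (λ z → F (K ℕ.+ r) - z) (shiftP-above K r F) ⟩
  sumTo (k ℕ.+ r) G + G (K ℕ.+ r) - F r       ≡⟨ cong₂ (λ x y → x + y - F r) head (geom-diagonal K f (K ℕ.+ r)) ⟩
  F r + f (K ℕ.+ r) - F r                     ≡⟨ cancel (F r) (f (K ℕ.+ r)) ⟩
  f (K ℕ.+ r)                                 ∎
  where
  K = suc k
  F = f ⊛ geom K
  G : ℕ → ℤ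
  G i = f i * geom K (K ℕ.+ r ∸ i)
  cancel : ∀ x y → x + y - x ≡ y
  cancel = solve-∀
  head : sumTo (k ℕ.+ r) G ≡ F r
  head = trans (sumTo-tail (k ℕ.+ r) r G (ℕP.m≤n+m r k) gap) (sumTo-cong r periodic)
    where
    gap : ∀ i → r < i → i ≤ k ℕ.+ r → G i ≡ 0ℤ
    gap i r<i i≤k+r = trans (cong (f i *_) (geom-small K (K ℕ.+ r ∸ i) (ℕP.m<n⇒0<n∸m (s≤s i≤k+r))
        (ℕP.<-≤-trans (ℕP.∸-monoʳ-< r<i (ℕP.m≤n⇒m≤1+n i≤k+r)) (ℕP.≤-reflexive (ℕP.m+n∸n≡m K r)))))
      (ℤP.*-zeroʳ (f i))
    periodic : ∀ i → i ≤ r → G i ≡ f i * geom K (r ∸ i)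
    periodic i i≤r = cong (f i *_) (trans (cong (geom K) (ℕP.+-∸-assoc K i≤r)) (geom-periodic K (r ∸ i)))

-- Polynomials in q with exponents linear in a point n of ℕ³

-- An exponent (c , x , y , z) stands for x n₁ + y n₂ + z n₃ + c, and ⟦ p ⟧ n g is the
-- series g multiplied by the polynomial p evaluated at n.

ℕ³ : Set
ℕ³ = ℕ × ℕ × ℕ

Exp : Set
Exp = ℕ × ℕ × ℕ × ℕ

ev : Exp → ℕ³ → ℕ
ev (c , x , y , z) (n₁ , n₂ , n₃) = x ℕ.* n₁ ℕ.+ y ℕ.* n₂ ℕ.+ z ℕ.* n₃ ℕ.+ c

constE : ℕ → Exp
constE c = (c , 0 , 0 , 0)

infixl 6 _⊕_

_⊕_ : Exp → Exp → Exp
(c , x , y , z) ⊕ (c′ , x′ , y′ , z′) = (c ℕ.+ c′ , x ℕ.+ x′ , y ℕ.+ y′ , z ℕ.+ z′)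

ev-⊕ : ∀ e e′ n → ev (e ⊕ e′) n ≡ ev e n ℕ.+ ev e′ n
ev-⊕ (c , x , y , z) (c′ , x′ , y′ , z′) (n₁ , n₂ , n₃) = distrib c x y z c′ x′ y′ z′ n₁ n₂ n₃
  where
  distrib : ∀ c x y z c′ x′ y′ z′ n₁ n₂ n₃ →
    (x ℕ.+ x′) ℕ.* n₁ ℕ.+ (y ℕ.+ y′) ℕ.* n₂ ℕ.+ (z ℕ.+ z′) ℕ.* n₃ ℕ.+ (c ℕ.+ c′)
    ≡ x ℕ.* n₁ ℕ.+ y ℕ.* n₂ ℕ.+ z ℕ.* n₃ ℕ.+ c ℕ.+ (x′ ℕ.* n₁ ℕ.+ y′ ℕ.* n₂ ℕ.+ z′ ℕ.* n₃ ℕ.+ c′)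
  distrib = NS.solve-∀

Poly : Set
Poly = List (ℤ × Exp)

⟦_⟧ : Poly → ℕ³ → PS → PS
⟦ []          ⟧ n g b = 0ℤ
⟦ (c , e) ∷ p ⟧ n g b = c * shiftP (ev e n) g b + ⟦ p ⟧ n g b

_◃_ : ℤ × Exp → Poly → Poly
(c , e) ◃ p = map (λ (c′ , e′) → (c * c′ , e ⊕ e′)) p

_·ᴾ_ : Poly → Poly → Poly
[]      ·ᴾ p′ = []
(m ∷ p) ·ᴾ p′ = m ◃ p′ ++ p ·ᴾ p′

module _ (n : ℕ³) where

  ⟦⟧-cong : ∀ p {g h : PS} → g ≗ h → ⟦ p ⟧ n g ≗ ⟦ p ⟧ n h
  ⟦⟧-cong []            g≗h b = refl
  ⟦⟧-cong ((c , e) ∷ p) g≗h b = cong₂ (λ x y → c * x + y) (shiftP-cong (ev e n) g≗h b) (⟦⟧-cong p g≗h b)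

  ⟦⟧-zero : ∀ p {g : PS} → g ≗ (λ _ → 0ℤ) → ⟦ p ⟧ n g ≗ λ _ → 0ℤ
  ⟦⟧-zero []            g≗0 b = refl
  ⟦⟧-zero ((c , e) ∷ p) {g} g≗0 b = begin
    c * shiftP (ev e n) g b + ⟦ p ⟧ n g b
      ≡⟨ cong₂ (λ x y → c * x + y) (shiftP-zero (ev e n) b g≗0) (⟦⟧-zero p g≗0 b) ⟩
    c * 0ℤ + 0ℤ
      ≡⟨ cong (_+ 0ℤ) (ℤP.*-zeroʳ c) ⟩
    0ℤ ∎

  ⟦⟧-++ : ∀ p p′ (g : PS) → ⟦ p ++ p′ ⟧ n g ≗ λ b → ⟦ p ⟧ n g b + ⟦ p′ ⟧ n g b
  ⟦⟧-++ []            p′ g b = sym (ℤP.+-identityˡ (⟦ p′ ⟧ n g b))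
  ⟦⟧-++ ((c , e) ∷ p) p′ g b =
    trans (cong (c * shiftP (ev e n) g b +_) (⟦⟧-++ p p′ g b))
          (sym (ℤP.+-assoc (c * shiftP (ev e n) g b) (⟦ p ⟧ n g b) (⟦ p′ ⟧ n g b)))

  shiftP-⟦⟧ : ∀ s p (g : PS) → shiftP s (⟦ p ⟧ n g) ≗ ⟦ p ⟧ n (shiftP s g)
  shiftP-⟦⟧ s []            g b = if-zero (s ≤ᵇ b)
  shiftP-⟦⟧ s ((c , e) ∷ p) g b = begin
    shiftP s (λ b → c * shiftP (ev e n) g b + ⟦ p ⟧ n g b) b
      ≡⟨ shiftP-map₂ s _+_ refl (λ b → c * shiftP (ev e n) g b) (⟦ p ⟧ n g) b ⟩
    shiftP s (λ b → c * shiftP (ev e n) g b) b + shiftP s (⟦ p ⟧ n g) b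
      ≡⟨ cong₂ _+_ (shiftP-map s (c *_) (ℤP.*-zeroʳ c) (shiftP (ev e n) g) b) (shiftP-⟦⟧ s p g b) ⟩
    c * shiftP s (shiftP (ev e n) g) b + ⟦ p ⟧ n (shiftP s g) b
      ≡⟨ cong (λ x → c * x + ⟦ p ⟧ n (shiftP s g) b) (shiftP-comm s (ev e n) g b) ⟩
    c * shiftP (ev e n) (shiftP s g) b + ⟦ p ⟧ n (shiftP s g) b ∎

  ⟦⟧-◃ : ∀ c e p (g : PS) → ⟦ (c , e) ◃ p ⟧ n g ≗ λ b → c * shiftP (ev e n) (⟦ p ⟧ n g) b
  ⟦⟧-◃ c e []              g b = sym (trans (cong (c *_) (if-zero (ev e n ≤ᵇ b))) (ℤP.*-zeroʳ c))
  ⟦⟧-◃ c e ((c′ , e′) ∷ p) g b = begin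
    c * c′ * shiftP (ev (e ⊕ e′) n) g b + ⟦ (c , e) ◃ p ⟧ n g b
      ≡⟨ cong₂ (λ x y → c * c′ * x + y) exponent (⟦⟧-◃ c e p g b) ⟩
    c * c′ * shiftP (ev e n) (shiftP (ev e′ n) g) b + c * shiftP (ev e n) (⟦ p ⟧ n g) b
      ≡⟨ factor c c′ (shiftP (ev e n) (shiftP (ev e′ n) g) b) (shiftP (ev e n) (⟦ p ⟧ n g) b) ⟩
    c * (c′ * shiftP (ev e n) (shiftP (ev e′ n) g) b + shiftP (ev e n) (⟦ p ⟧ n g) b)
      ≡⟨ cong (λ x → c * (x + shiftP (ev e n) (⟦ p ⟧ n g) b))
              (shiftP-map (ev e n) (c′ *_) (ℤP.*-zeroʳ c′) (shiftP (ev e′ n) g) b) ⟨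
    c * (shiftP (ev e n) (λ b → c′ * shiftP (ev e′ n) g b) b + shiftP (ev e n) (⟦ p ⟧ n g) b)
      ≡⟨ cong (c *_) (shiftP-map₂ (ev e n) _+_ refl (λ b → c′ * shiftP (ev e′ n) g b) (⟦ p ⟧ n g) b) ⟨
    c * shiftP (ev e n) (⟦ (c′ , e′) ∷ p ⟧ n g) b ∎
    where
    exponent : shiftP (ev (e ⊕ e′) n) g b ≡ shiftP (ev e n) (shiftP (ev e′ n) g) b
    exponent = trans (cong (λ k → shiftP k g b) (trans (ev-⊕ e e′ n) (ℕP.+-comm (ev e n) (ev e′ n))))
                     (sym (shiftP-shiftP (ev e n) (ev e′ n) g b))
    factor : ∀ c c′ x y → c * c′ * x + c * y ≡ c * (c′ * x + y)
    factor = solve-∀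

  ⟦⟧-·ᴾ : ∀ p p′ (g : PS) → ⟦ p ·ᴾ p′ ⟧ n g ≗ ⟦ p ⟧ n (⟦ p′ ⟧ n g)
  ⟦⟧-·ᴾ []            p′ g b = refl
  ⟦⟧-·ᴾ ((c , e) ∷ p) p′ g b =
    trans (⟦⟧-++ ((c , e) ◃ p′) (p ·ᴾ p′) g b) (cong₂ _+_ (⟦⟧-◃ c e p′ g b) (⟦⟧-·ᴾ p p′ g b))

  ⟦⟧-⊛ˡ : ∀ p (f g : PS) → (⟦ p ⟧ n f ⊛ g) ≗ ⟦ p ⟧ n (f ⊛ g)
  ⟦⟧-⊛ˡ []            f g = ⊛-zeroˡ g
  ⟦⟧-⊛ˡ ((c , e) ∷ p) f g m = begin
    ((λ b → c * shiftP (ev e n) f b + ⟦ p ⟧ n f b) ⊛ g) m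
      ≡⟨ ⊛-linearˡ c (shiftP (ev e n) f) (⟦ p ⟧ n f) g m ⟩
    c * (shiftP (ev e n) f ⊛ g) m + (⟦ p ⟧ n f ⊛ g) m
      ≡⟨ cong₂ (λ x y → c * x + y) (shiftP-⊛ˡ (ev e n) f g m) (⟦⟧-⊛ˡ p f g m) ⟩
    c * shiftP (ev e n) (f ⊛ g) m + ⟦ p ⟧ n (f ⊛ g) m ∎

  ⟦⟧-⊛ʳ : ∀ p (f g : PS) → (f ⊛ ⟦ p ⟧ n g) ≗ ⟦ p ⟧ n (f ⊛ g)
  ⟦⟧-⊛ʳ []            f g = ⊛-zeroʳ f
  ⟦⟧-⊛ʳ ((c , e) ∷ p) f g m = begin
    (f ⊛ (λ b → c * shiftP (ev e n) g b + ⟦ p ⟧ n g b)) m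
      ≡⟨ ⊛-linearʳ c f (shiftP (ev e n) g) (⟦ p ⟧ n g) m ⟩
    c * (f ⊛ shiftP (ev e n) g) m + (f ⊛ ⟦ p ⟧ n g) m
      ≡⟨ cong₂ (λ x y → c * x + y) (shiftP-⊛ʳ (ev e n) f g m) (⟦⟧-⊛ʳ p f g m) ⟩
    c * shiftP (ev e n) (f ⊛ g) m + ⟦ p ⟧ n (f ⊛ g) m ∎

∑ : List ℤ → ℤ
∑ = foldr _+_ 0ℤ

∑-⟦⟧ : ∀ {A : Set} c n (p : A → Poly) (g : PS) b ts →
  ∑ (map (λ t → c * ⟦ p t ⟧ n g b) ts) ≡ c * ⟦ concatMap p ts ⟧ n g b
∑-⟦⟧ c n p g b []       = sym (ℤP.*-zeroʳ c)
∑-⟦⟧ c n p g b (t ∷ ts) = begin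
  c * ⟦ p t ⟧ n g b + ∑ (map (λ t → c * ⟦ p t ⟧ n g b) ts)  ≡⟨ cong (c * ⟦ p t ⟧ n g b +_) (∑-⟦⟧ c n p g b ts) ⟩
  c * ⟦ p t ⟧ n g b + c * ⟦ concatMap p ts ⟧ n g b          ≡⟨ ℤP.*-distribˡ-+ c _ _ ⟨
  c * (⟦ p t ⟧ n g b + ⟦ concatMap p ts ⟧ n g b)            ≡⟨ cong (c *_) (⟦⟧-++ n (p t) (concatMap p ts) g b) ⟨
  c * ⟦ p t ++ concatMap p ts ⟧ n g b                       ∎

collect : ∀ c c′ x y → (c + c′) * x + y ≡ c * x + (c′ * x + y)
collect = solve-∀

_≟ᴱ_ : DecidableEquality Exp
_≟ᴱ_ = ≡-dec ℕP._≟_ (≡-dec ℕP._≟_ (≡-dec ℕP._≟_ ℕP._≟_))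

insert : ℤ × Exp → Poly → Poly
insert m             []              = m ∷ []
insert (c , e) ((c′ , e′) ∷ p) with e ≟ᴱ e′ | c + c′ ℤ.≟ 0ℤ
... | yes _ | yes _ = p
... | yes _ | no _  = (c + c′ , e′) ∷ p
... | no _  | _     = (c′ , e′) ∷ insert (c , e) p

normalise : Poly → Poly
normalise = foldr insert []

module _ (n : ℕ³) where

  ⟦⟧-insert : ∀ m p (g : PS) → ⟦ insert m p ⟧ n g ≗ ⟦ m ∷ p ⟧ n g
  ⟦⟧-insert m       []              g b = refl
  ⟦⟧-insert (c , e) ((c′ , e′) ∷ p) g b with e ≟ᴱ e′ | c + c′ ℤ.≟ 0ℤ
  ... | yes refl | yes c+c′≡0 = begin
    ⟦ p ⟧ n g b                 ≡⟨ ℤP.+-identityˡ (⟦ p ⟧ n g b) ⟨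
    0ℤ + ⟦ p ⟧ n g b            ≡⟨ cong (_+ ⟦ p ⟧ n g b) (trans (cong (_* X) c+c′≡0) (ℤP.*-zeroˡ X)) ⟨
    (c + c′) * X + ⟦ p ⟧ n g b  ≡⟨ collect c c′ X (⟦ p ⟧ n g b) ⟩
    c * X + (c′ * X + ⟦ p ⟧ n g b) ∎
    where
    X = shiftP (ev e n) g b
  ... | yes refl | no _ = collect c c′ (shiftP (ev e n) g b) (⟦ p ⟧ n g b)
  ... | no _ | _ = begin
    c′ * Y + ⟦ insert (c , e) p ⟧ n g b   ≡⟨ cong (c′ * Y +_) (⟦⟧-insert (c , e) p g b) ⟩
    c′ * Y + (c * X + ⟦ p ⟧ n g b)        ≡⟨ swap (c′ * Y) (c * X) (⟦ p ⟧ n g b) ⟩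
    c * X + (c′ * Y + ⟦ p ⟧ n g b)        ∎
    where
    X = shiftP (ev e n) g b
    Y = shiftP (ev e′ n) g b
    swap : ∀ x y z → x + (y + z) ≡ y + (x + z)
    swap = solve-∀

  ⟦⟧-normalise : ∀ p (g : PS) → ⟦ normalise p ⟧ n g ≗ ⟦ p ⟧ n g
  ⟦⟧-normalise []      g b = refl
  ⟦⟧-normalise ((c , e) ∷ p) g b =
    trans (⟦⟧-insert (c , e) (normalise p) g b) (cong (c * shiftP (ev e n) g b +_) (⟦⟧-normalise p g b))

-- q-Pochhammer quotients

C₂-suc : ∀ n → suc n C 2 ≡ n C 2 ℕ.+ n
C₂-suc n = begin
  suc n C 2         ≡⟨ nCk+nC[k+1]≡[n+1]C[k+1] n 1 ⟨
  n C 1 ℕ.+ n C 2   ≡⟨ cong (ℕ._+ n C 2) (nC1≡n n) ⟩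
  n ℕ.+ n C 2       ≡⟨ ℕP.+-comm n (n C 2) ⟩
  n C 2 ℕ.+ n       ∎

binomial : ℕ → Exp → Poly
binomial t u = (1ℤ , constE t) ∷ (-1ℤ , u) ∷ []

-- With q^u = q^(s N) this is ∏_{j<k} (q^(s j) - q^(s N)) = q^(s·k(k-1)/2) (q^(s(N-k+1)); q^s)_k.
fall : ℕ → Exp → ℕ → Poly
fall s u zero    = (1ℤ , constE 0) ∷ []
fall s u (suc k) = binomial (s ℕ.* k) u ·ᴾ fall s u k

module _ (n : ℕ³) where

  ⟦binomial⟧ : ∀ t u (g : PS) → ⟦ binomial t u ⟧ n g ≗ λ b → shiftP t g b - shiftP (ev u n) g b
  ⟦binomial⟧ t u g b = simplify (shiftP t g b) (shiftP (ev u n) g b)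
    where
    simplify : ∀ x y → 1ℤ * x + (-1ℤ * y + 0ℤ) ≡ x - y
    simplify = solve-∀

  ⟦fall-zero⟧ : ∀ s u (g : PS) → ⟦ fall s u 0 ⟧ n g ≗ g
  ⟦fall-zero⟧ s u g b = trans (ℤP.+-identityʳ (1ℤ * g b)) (ℤP.*-identityˡ (g b))

  ⟦fall-suc⟧ : ∀ s u k (g : PS) →
    ⟦ fall s u (suc k) ⟧ n g ≗ λ b → shiftP (s ℕ.* k) (⟦ fall s u k ⟧ n g) b - shiftP (ev u n) (⟦ fall s u k ⟧ n g) b
  ⟦fall-suc⟧ s u k g b =
    trans (⟦⟧-·ᴾ n (binomial (s ℕ.* k) u) (fall s u k) g b) (⟦binomial⟧ (s ℕ.* k) u (⟦ fall s u k ⟧ n g) b)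

  -- One factor is q^(s r) - q^(s r) = 0.
  ⟦fall⟧-vanishes : ∀ s u r k → ev u n ≡ s ℕ.* r → r < k → ∀ (g : PS) → ⟦ fall s u k ⟧ n g ≗ λ _ → 0ℤ
  ⟦fall⟧-vanishes s u r (suc k) u≡sr r<1+k g b with ℕP.m≤n⇒m<n∨m≡n (ℕP.≤-pred r<1+k)
  ... | inj₁ r<k = trans (⟦⟧-·ᴾ n (binomial (s ℕ.* k) u) (fall s u k) g b)
                         (⟦⟧-zero n (binomial (s ℕ.* k) u) (⟦fall⟧-vanishes s u r k u≡sr r<k g) b)
  ... | inj₂ refl = begin
    ⟦ fall s u (suc r) ⟧ n g b                 ≡⟨ ⟦fall-suc⟧ s u r g b ⟩
    shiftP (s ℕ.* r) Y b - shiftP (ev u n) Y b ≡⟨ cong (λ t → shiftP (s ℕ.* r) Y b - shiftP t Y b) u≡sr ⟩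
    shiftP (s ℕ.* r) Y b - shiftP (s ℕ.* r) Y b ≡⟨ ℤP.+-inverseʳ (shiftP (s ℕ.* r) Y b) ⟩
    0ℤ                                         ∎
    where
    Y = ⟦ fall s u r ⟧ n g

  invPoch-fall : ∀ s′ k m u → let s = suc s′ in ev u n ≡ s ℕ.* (k ℕ.+ m) →
    shiftP (s ℕ.* (k C 2)) (invPoch s m) ≗ ⟦ fall s u k ⟧ n (invPoch s (k ℕ.+ m))
  invPoch-fall s′ zero m u _ b =
    trans (cong (λ t → shiftP t (invPoch (suc s′) m) b) (ℕP.*-zeroʳ s′))
          (sym (⟦fall-zero⟧ (suc s′) u (invPoch (suc s′) m) b))
  invPoch-fall s′ (suc k) m u u≡s[1+k+m] b = begin
    shiftP (s ℕ.* (suc k C 2)) (I m) b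
      ≡⟨ cong (λ t → shiftP t (I m) b) (trans (cong (s ℕ.*_) (C₂-suc k)) (ℕP.*-distribˡ-+ s (k C 2) k)) ⟩
    shiftP (s ℕ.* (k C 2) ℕ.+ s ℕ.* k) (I m) b
      ≡⟨ shiftP-shiftP (s ℕ.* k) (s ℕ.* (k C 2)) (I m) b ⟨
    shiftP (s ℕ.* k) (shiftP (s ℕ.* (k C 2)) (I m)) b
      ≡⟨ shiftP-cong (s ℕ.* k) peel b ⟩
    shiftP (s ℕ.* k) (λ b → Y b - shiftP K Y b) b
      ≡⟨ shiftP-map₂ (s ℕ.* k) _-_ refl Y (shiftP K Y) b ⟩
    shiftP (s ℕ.* k) Y b - shiftP (s ℕ.* k) (shiftP K Y) b
      ≡⟨ cong (λ x → shiftP (s ℕ.* k) Y b - x) (trans (shiftP-shiftP (s ℕ.* k) K Y b)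
              (cong (λ t → shiftP t Y b) (trans (exponent s m k) (sym u≡s[1+k+m])))) ⟩
    shiftP (s ℕ.* k) Y b - shiftP (ev u n) Y b
      ≡⟨ ⟦fall-suc⟧ s u k (I (k ℕ.+ suc m)) b ⟨
    ⟦ fall s u (suc k) ⟧ n (I (k ℕ.+ suc m)) b
      ≡⟨ cong (λ j → ⟦ fall s u (suc k) ⟧ n (I j) b) (ℕP.+-suc k m) ⟩
    ⟦ fall s u (suc k) ⟧ n (I (suc k ℕ.+ m)) b ∎
    where
    s = suc s′
    I = invPoch s
    K = s ℕ.* suc m
    Y = ⟦ fall s u k ⟧ n (I (k ℕ.+ suc m))
    exponent : ∀ s m k → s ℕ.* (1 ℕ.+ m) ℕ.+ s ℕ.* k ≡ s ℕ.* (1 ℕ.+ k ℕ.+ m)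
    exponent = NS.solve-∀
    next : shiftP (s ℕ.* (k C 2)) (I (suc m)) ≗ Y
    next = invPoch-fall s′ k (suc m) u (trans u≡s[1+k+m] (cong (s ℕ.*_) (sym (ℕP.+-suc k m))))
    peel : shiftP (s ℕ.* (k C 2)) (I m) ≗ λ b → Y b - shiftP K Y b
    peel b = begin
      shiftP (s ℕ.* (k C 2)) (I m) b
        ≡⟨ shiftP-cong (s ℕ.* (k C 2)) (λ b → sym (geom-inverse (m ℕ.+ s′ ℕ.* suc m) (I m) b)) b ⟩
      shiftP (s ℕ.* (k C 2)) (λ b → I (suc m) b - shiftP K (I (suc m)) b) b
        ≡⟨ shiftP-map₂ (s ℕ.* (k C 2)) _-_ refl (I (suc m)) (shiftP K (I (suc m))) b ⟩
      shiftP (s ℕ.* (k C 2)) (I (suc m)) b - shiftP (s ℕ.* (k C 2)) (shiftP K (I (suc m))) b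
        ≡⟨ cong₂ _-_ (next b) (trans (shiftP-comm (s ℕ.* (k C 2)) K (I (suc m)) b) (shiftP-cong K next b)) ⟩
      Y b - shiftP K Y b ∎

_+³_ : ℕ³ → ℕ³ → ℕ³
(k₁ , k₂ , k₃) +³ (m₁ , m₂ , m₃) = (k₁ ℕ.+ m₁ , k₂ ℕ.+ m₂ , k₃ ℕ.+ m₃)

_≰³_ : ℕ³ → ℕ³ → Set
(k₁ , k₂ , k₃) ≰³ (n₁ , n₂ , n₃) = n₁ < k₁ ⊎ n₂ < k₂ ⊎ n₃ < k₃

invPoch³ : ℕ³ → PS
invPoch³ (n₁ , n₂ , n₃) = (invPoch 2 n₁ ⊛ invPoch 2 n₂) ⊛ invPoch 6 n₃

u₁ u₂ u₃ : Exp
u₁ = (0 , 2 , 0 , 0)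
u₂ = (0 , 0 , 2 , 0)
u₃ = (0 , 0 , 0 , 6)

ev-u₁ : ∀ n₁ n₂ n₃ → ev u₁ (n₁ , n₂ , n₃) ≡ 2 ℕ.* n₁
ev-u₁ n₁ n₂ n₃ = trans (ℕP.+-identityʳ _) (trans (ℕP.+-identityʳ _) (ℕP.+-identityʳ _))

ev-u₂ : ∀ n₁ n₂ n₃ → ev u₂ (n₁ , n₂ , n₃) ≡ 2 ℕ.* n₂
ev-u₂ n₁ n₂ n₃ = trans (ℕP.+-identityʳ _) (ℕP.+-identityʳ _)

ev-u₃ : ∀ n₁ n₂ n₃ → ev u₃ (n₁ , n₂ , n₃) ≡ 6 ℕ.* n₃
ev-u₃ n₁ n₂ n₃ = ℕP.+-identityʳ _

falls : ℕ³ → Poly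
falls (k₁ , k₂ , k₃) = fall 6 u₃ k₃ ·ᴾ (fall 2 u₂ k₂ ·ᴾ fall 2 u₁ k₁)

fallExp : ℕ³ → ℕ
fallExp (k₁ , k₂ , k₃) = 2 ℕ.* (k₁ C 2) ℕ.+ 2 ℕ.* (k₂ C 2) ℕ.+ 6 ℕ.* (k₃ C 2)

invPoch³-falls : ∀ κ m → shiftP (fallExp κ) (invPoch³ m) ≗ ⟦ falls κ ⟧ (κ +³ m) (invPoch³ (κ +³ m))
invPoch³-falls κ@(k₁ , k₂ , k₃) (m₁ , m₂ , m₃) b = begin
  shiftP (fallExp κ) ((I₁ ⊛ I₂) ⊛ I₃) b
    ≡⟨ shiftP-⊛ (2 ℕ.* (k₁ C 2) ℕ.+ 2 ℕ.* (k₂ C 2)) (6 ℕ.* (k₃ C 2)) (I₁ ⊛ I₂) I₃ b ⟩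
  (shiftP (2 ℕ.* (k₁ C 2) ℕ.+ 2 ℕ.* (k₂ C 2)) (I₁ ⊛ I₂) ⊛ shiftP (6 ℕ.* (k₃ C 2)) I₃) b
    ≡⟨ ⊛-congˡ (shiftP (6 ℕ.* (k₃ C 2)) I₃) (shiftP-⊛ (2 ℕ.* (k₁ C 2)) (2 ℕ.* (k₂ C 2)) I₁ I₂) b ⟩
  ((shiftP (2 ℕ.* (k₁ C 2)) I₁ ⊛ shiftP (2 ℕ.* (k₂ C 2)) I₂) ⊛ shiftP (6 ℕ.* (k₃ C 2)) I₃) b
    ≡⟨ ⊛-cong (⊛-cong (invPoch-fall n 1 k₁ m₁ u₁ (ev-u₁ (k₁ ℕ.+ m₁) (k₂ ℕ.+ m₂) (k₃ ℕ.+ m₃)))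
                      (invPoch-fall n 1 k₂ m₂ u₂ (ev-u₂ (k₁ ℕ.+ m₁) (k₂ ℕ.+ m₂) (k₃ ℕ.+ m₃))))
              (invPoch-fall n 5 k₃ m₃ u₃ (ev-u₃ (k₁ ℕ.+ m₁) (k₂ ℕ.+ m₂) (k₃ ℕ.+ m₃))) b ⟩
  ((⟦ F₁ ⟧ n J₁ ⊛ ⟦ F₂ ⟧ n J₂) ⊛ ⟦ F₃ ⟧ n J₃) b
    ≡⟨ ⟦⟧-⊛ʳ n F₃ (⟦ F₁ ⟧ n J₁ ⊛ ⟦ F₂ ⟧ n J₂) J₃ b ⟩
  ⟦ F₃ ⟧ n ((⟦ F₁ ⟧ n J₁ ⊛ ⟦ F₂ ⟧ n J₂) ⊛ J₃) b
    ≡⟨ ⟦⟧-cong n F₃ (λ b → trans (⊛-congˡ J₃ (λ b → trans (⟦⟧-⊛ʳ n F₂ (⟦ F₁ ⟧ n J₁) J₂ b)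
                                                         (⟦⟧-cong n F₂ (⟦⟧-⊛ˡ n F₁ J₁ J₂) b)) b)
                                 (trans (⟦⟧-⊛ˡ n F₂ (⟦ F₁ ⟧ n (J₁ ⊛ J₂)) J₃ b)
                                        (⟦⟧-cong n F₂ (⟦⟧-⊛ˡ n F₁ (J₁ ⊛ J₂) J₃) b))) b ⟩
  ⟦ F₃ ⟧ n (⟦ F₂ ⟧ n (⟦ F₁ ⟧ n ((J₁ ⊛ J₂) ⊛ J₃))) b
    ≡⟨ trans (⟦⟧-·ᴾ n F₃ (F₂ ·ᴾ F₁) P b) (⟦⟧-cong n F₃ (⟦⟧-·ᴾ n F₂ F₁ P) b) ⟨
  ⟦ falls κ ⟧ n ((J₁ ⊛ J₂) ⊛ J₃) b ∎
  where
  n = κ +³ (m₁ , m₂ , m₃)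
  F₁ = fall 2 u₁ k₁
  F₂ = fall 2 u₂ k₂
  F₃ = fall 6 u₃ k₃
  I₁ = invPoch 2 m₁
  I₂ = invPoch 2 m₂
  I₃ = invPoch 6 m₃
  J₁ = invPoch 2 (k₁ ℕ.+ m₁)
  J₂ = invPoch 2 (k₂ ℕ.+ m₂)
  J₃ = invPoch 6 (k₃ ℕ.+ m₃)
  P = (J₁ ⊛ J₂) ⊛ J₃

⟦falls⟧-vanishes : ∀ κ n → κ ≰³ n → ∀ (g : PS) → ⟦ falls κ ⟧ n g ≗ λ _ → 0ℤ
⟦falls⟧-vanishes (k₁ , k₂ , k₃) n@(n₁ , n₂ , n₃) κ≰n g b =
  trans (⟦⟧-·ᴾ n F₃ (F₂ ·ᴾ F₁) g b) (vanish κ≰n)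
  where
  F₁ = fall 2 u₁ k₁
  F₂ = fall 2 u₂ k₂
  F₃ = fall 6 u₃ k₃
  vanish : (k₁ , k₂ , k₃) ≰³ n → ⟦ F₃ ⟧ n (⟦ F₂ ·ᴾ F₁ ⟧ n g) b ≡ 0ℤ
  vanish (inj₁ n₁<k₁) = ⟦⟧-zero n F₃ (λ b → trans (⟦⟧-·ᴾ n F₂ F₁ g b)
    (⟦⟧-zero n F₂ (⟦fall⟧-vanishes n 2 u₁ n₁ k₁ (ev-u₁ n₁ n₂ n₃) n₁<k₁ g) b)) b
  vanish (inj₂ (inj₁ n₂<k₂)) = ⟦⟧-zero n F₃ (λ b → trans (⟦⟧-·ᴾ n F₂ F₁ g b)
    (⟦fall⟧-vanishes n 2 u₂ n₂ k₂ (ev-u₂ n₁ n₂ n₃) n₂<k₂ (⟦ F₁ ⟧ n g) b)) b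
  vanish (inj₂ (inj₂ n₃<k₃)) = ⟦fall⟧-vanishes n 6 u₃ n₃ k₃ (ev-u₃ n₁ n₂ n₃) n₃<k₃ (⟦ F₂ ·ᴾ F₁ ⟧ n g) b

-- Exponents of q

C₂-+ : ∀ k m → (k ℕ.+ m) C 2 ≡ k C 2 ℕ.+ m C 2 ℕ.+ k ℕ.* m
C₂-+ zero    m = sym (ℕP.+-identityʳ (m C 2))
C₂-+ (suc k) m = begin
  suc (k ℕ.+ m) C 2                              ≡⟨ C₂-suc (k ℕ.+ m) ⟩
  (k ℕ.+ m) C 2 ℕ.+ (k ℕ.+ m)                    ≡⟨ cong (ℕ._+ (k ℕ.+ m)) (C₂-+ k m) ⟩
  k C 2 ℕ.+ m C 2 ℕ.+ k ℕ.* m ℕ.+ (k ℕ.+ m)      ≡⟨ regroup (k C 2) (m C 2) k m ⟩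
  k C 2 ℕ.+ k ℕ.+ m C 2 ℕ.+ suc k ℕ.* m          ≡⟨ cong (λ x → x ℕ.+ m C 2 ℕ.+ suc k ℕ.* m) (C₂-suc k) ⟨
  suc k C 2 ℕ.+ m C 2 ℕ.+ suc k ℕ.* m            ∎
  where
  regroup : ∀ a b k m → a ℕ.+ b ℕ.+ k ℕ.* m ℕ.+ (k ℕ.+ m) ≡ a ℕ.+ k ℕ.+ b ℕ.+ (1 ℕ.+ k) ℕ.* m
  regroup = NS.solve-∀

weight : ℕ³ → ℕ
weight (n₁ , n₂ , n₃) = n₁ ℕ.+ 2 ℕ.* n₂ ℕ.+ 3 ℕ.* n₃

expo³ : ℕ³ → ℕ
expo³ (n₁ , n₂ , n₃) = expo n₁ n₂ n₃

-- expo (κ + m) - expo m is the linear form crossExp κ in m.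
crossExp : ℕ³ → Exp
crossExp κ@(k₁ , k₂ , k₃) =
  ( expo³ κ
  , 4 ℕ.* k₁ ℕ.+ 2 ℕ.* k₂ ℕ.+ 6 ℕ.* k₃
  , 2 ℕ.* k₁ ℕ.+ 4 ℕ.* k₂ ℕ.+ 6 ℕ.* k₃
  , 6 ℕ.* k₁ ℕ.+ 6 ℕ.* k₂ ℕ.+ 18 ℕ.* k₃ )

expo-+ : ∀ κ m → expo³ (κ +³ m) ≡ ev (crossExp κ) m ℕ.+ expo³ m
expo-+ (k₁ , k₂ , k₃) (m₁ , m₂ , m₃)
  rewrite C₂-+ k₁ m₁ | C₂-+ k₂ m₂ | C₂-+ k₃ m₃ =
  expand k₁ k₂ k₃ m₁ m₂ m₃ (k₁ C 2) (k₂ C 2) (k₃ C 2) (m₁ C 2) (m₂ C 2) (m₃ C 2)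
  where
  expand : ∀ k₁ k₂ k₃ m₁ m₂ m₃ a₁ a₂ a₃ b₁ b₂ b₃ →
    4 ℕ.* (a₁ ℕ.+ b₁ ℕ.+ k₁ ℕ.* m₁) ℕ.+ 4 ℕ.* (a₂ ℕ.+ b₂ ℕ.+ k₂ ℕ.* m₂) ℕ.+ 18 ℕ.* (a₃ ℕ.+ b₃ ℕ.+ k₃ ℕ.* m₃)
    ℕ.+ 2 ℕ.* (k₁ ℕ.+ m₁) ℕ.* (k₂ ℕ.+ m₂) ℕ.+ 6 ℕ.* (k₂ ℕ.+ m₂) ℕ.* (k₃ ℕ.+ m₃) ℕ.+ 6 ℕ.* (k₃ ℕ.+ m₃) ℕ.* (k₁ ℕ.+ m₁)
    ℕ.+ (k₁ ℕ.+ m₁) ℕ.+ 2 ℕ.* (k₂ ℕ.+ m₂) ℕ.+ 9 ℕ.* (k₃ ℕ.+ m₃)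
    ≡ (4 ℕ.* k₁ ℕ.+ 2 ℕ.* k₂ ℕ.+ 6 ℕ.* k₃) ℕ.* m₁ ℕ.+ (2 ℕ.* k₁ ℕ.+ 4 ℕ.* k₂ ℕ.+ 6 ℕ.* k₃) ℕ.* m₂
      ℕ.+ (6 ℕ.* k₁ ℕ.+ 6 ℕ.* k₂ ℕ.+ 18 ℕ.* k₃) ℕ.* m₃
      ℕ.+ (4 ℕ.* a₁ ℕ.+ 4 ℕ.* a₂ ℕ.+ 18 ℕ.* a₃ ℕ.+ 2 ℕ.* k₁ ℕ.* k₂ ℕ.+ 6 ℕ.* k₂ ℕ.* k₃ ℕ.+ 6 ℕ.* k₃ ℕ.* k₁
           ℕ.+ k₁ ℕ.+ 2 ℕ.* k₂ ℕ.+ 9 ℕ.* k₃)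
      ℕ.+ (4 ℕ.* b₁ ℕ.+ 4 ℕ.* b₂ ℕ.+ 18 ℕ.* b₃ ℕ.+ 2 ℕ.* m₁ ℕ.* m₂ ℕ.+ 6 ℕ.* m₂ ℕ.* m₃ ℕ.+ 6 ℕ.* m₃ ℕ.* m₁
           ℕ.+ m₁ ℕ.+ 2 ℕ.* m₂ ℕ.+ 9 ℕ.* m₃)
  expand = NS.solve-∀

recentre : Exp → ℕ³ → Exp
recentre e@(_ , x , y , z) κ = (ev e κ , x , y , z)

ev-recentre : ∀ e κ m → ev (recentre e κ) m ≡ ev e (κ +³ m)
ev-recentre (c , x , y , z) (k₁ , k₂ , k₃) (m₁ , m₂ , m₃) = expand c x y z k₁ k₂ k₃ m₁ m₂ m₃
  where
  expand : ∀ c x y z k₁ k₂ k₃ m₁ m₂ m₃ →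
    x ℕ.* m₁ ℕ.+ y ℕ.* m₂ ℕ.+ z ℕ.* m₃ ℕ.+ (x ℕ.* k₁ ℕ.+ y ℕ.* k₂ ℕ.+ z ℕ.* k₃ ℕ.+ c)
    ≡ x ℕ.* (k₁ ℕ.+ m₁) ℕ.+ y ℕ.* (k₂ ℕ.+ m₂) ℕ.+ z ℕ.* (k₃ ℕ.+ m₃) ℕ.+ c
  expand = NS.solve-∀

-- Balanced j k κ f says j + k·weight m + expo m = fallExp κ + f (κ + m) + expo (κ + m) for all m:
-- since expo's quadratic part cancels, it is an equation between coefficient vectors of linear
-- forms in m, decided by computation.
Balanced : ℕ → ℕ → ℕ³ → Exp → Set
Balanced j k κ f = (j , k , 2 ℕ.* k , 3 ℕ.* k) ≡ constE (fallExp κ) ⊕ recentre f κ ⊕ crossExp κ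

exponent-match : ∀ j k κ f → Balanced j k κ f → ∀ m →
  expo³ m ℕ.+ (k ℕ.* weight m ℕ.+ j) ≡ fallExp κ ℕ.+ (expo³ (κ +³ m) ℕ.+ ev f (κ +³ m))
exponent-match j k κ f balanced m@(m₁ , m₂ , m₃) = begin
  expo³ m ℕ.+ (k ℕ.* weight m ℕ.+ j)
    ≡⟨ cong (expo³ m ℕ.+_) (linear k j m₁ m₂ m₃) ⟩
  expo³ m ℕ.+ ev (j , k , 2 ℕ.* k , 3 ℕ.* k) m
    ≡⟨ cong (λ e → expo³ m ℕ.+ ev e m) balanced ⟩
  expo³ m ℕ.+ ev (constE (fallExp κ) ⊕ recentre f κ ⊕ crossExp κ) m
    ≡⟨ cong (expo³ m ℕ.+_) (trans (ev-⊕ (constE (fallExp κ) ⊕ recentre f κ) (crossExp κ) m)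
                                  (cong (ℕ._+ ev (crossExp κ) m) (ev-⊕ (constE (fallExp κ)) (recentre f κ) m))) ⟩
  expo³ m ℕ.+ (fallExp κ ℕ.+ ev (recentre f κ) m ℕ.+ ev (crossExp κ) m)
    ≡⟨ cong (λ x → expo³ m ℕ.+ (fallExp κ ℕ.+ x ℕ.+ ev (crossExp κ) m)) (ev-recentre f κ m) ⟩
  expo³ m ℕ.+ (fallExp κ ℕ.+ ev f (κ +³ m) ℕ.+ ev (crossExp κ) m)
    ≡⟨ regroup (expo³ m) (fallExp κ) (ev f (κ +³ m)) (ev (crossExp κ) m) ⟩
  fallExp κ ℕ.+ (ev (crossExp κ) m ℕ.+ expo³ m ℕ.+ ev f (κ +³ m))
    ≡⟨ cong (λ x → fallExp κ ℕ.+ (x ℕ.+ ev f (κ +³ m))) (expo-+ κ m) ⟨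
  fallExp κ ℕ.+ (expo³ (κ +³ m) ℕ.+ ev f (κ +³ m)) ∎
  where
  linear : ∀ k j m₁ m₂ m₃ → k ℕ.* (m₁ ℕ.+ 2 ℕ.* m₂ ℕ.+ 3 ℕ.* m₃) ℕ.+ j
                          ≡ k ℕ.* m₁ ℕ.+ 2 ℕ.* k ℕ.* m₂ ℕ.+ 3 ℕ.* k ℕ.* m₃ ℕ.+ j
  linear = NS.solve-∀
  regroup : ∀ e F x c → e ℕ.+ (F ℕ.+ x ℕ.+ c) ≡ F ℕ.+ (c ℕ.+ e ℕ.+ x)
  regroup = NS.solve-∀

-- Coefficients of x as sums over simplices

box : ℕ³ → (ℕ³ → ℤ) → ℤ
box (N₁ , N₂ , N₃) h = sumTo N₁ λ n₁ → sumTo N₂ λ n₂ → sumTo N₃ λ n₃ → h (n₁ , n₂ , n₃)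

simplexSum : ℕ → (ℕ³ → ℤ) → ℤ
simplexSum a h = box (a , a , a) λ n → if weight n ≡ᵇ a then h n else 0ℤ

term³ : ℕ³ → PS
term³ (n₁ , n₂ , n₃) = term n₁ n₂ n₃


box-cong : ∀ N {h h′ : ℕ³ → ℤ} → h ≗ h′ → box N h ≡ box N h′
box-cong (N₁ , N₂ , N₃) h≗h′ =
  sumTo-congᶠ N₁ λ n₁ → sumTo-congᶠ N₂ λ n₂ → sumTo-congᶠ N₃ λ n₃ → h≗h′ (n₁ , n₂ , n₃)

box-zero : ∀ N {h : ℕ³ → ℤ} → (∀ n → h n ≡ 0ℤ) → box N h ≡ 0ℤ
box-zero (N₁ , N₂ , N₃) h≡0 =
  sumTo-zero N₁ λ n₁ _ → sumTo-zero N₂ λ n₂ _ → sumTo-zero N₃ λ n₃ _ → h≡0 (n₁ , n₂ , n₃)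

box-+ : ∀ N (h h′ : ℕ³ → ℤ) → box N (λ n → h n + h′ n) ≡ box N h + box N h′
box-+ (N₁ , N₂ , N₃) h h′ = trans
  (sumTo-congᶠ N₁ λ n₁ → trans (sumTo-congᶠ N₂ λ n₂ → sumTo-+ N₃ _ _) (sumTo-+ N₂ _ _))
  (sumTo-+ N₁ _ _)

box-* : ∀ N c (h : ℕ³ → ℤ) → box N (λ n → c * h n) ≡ c * box N h
box-* (N₁ , N₂ , N₃) c h = trans
  (sumTo-congᶠ N₁ λ n₁ → trans (sumTo-congᶠ N₂ λ n₂ → sumTo-* N₃ c _) (sumTo-* N₂ c _))
  (sumTo-* N₁ c _)

box-shrink : ∀ {M₁ M₂ M₃ N₁ N₂ N₃} (h : ℕ³ → ℤ) → M₁ ≤ N₁ → M₂ ≤ N₂ → M₃ ≤ N₃ →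
  (∀ n → n ≰³ (M₁ , M₂ , M₃) → h n ≡ 0ℤ) → box (N₁ , N₂ , N₃) h ≡ box (M₁ , M₂ , M₃) h
box-shrink {M₁} {M₂} {M₃} {N₁} {N₂} {N₃} h M₁≤N₁ M₂≤N₂ M₃≤N₃ outside≡0 = begin
  box (N₁ , N₂ , N₃) h
    ≡⟨ sumTo-congᶠ N₁ (λ n₁ → sumTo-congᶠ N₂ λ n₂ → sumTo-tail N₃ M₃ _ M₃≤N₃ λ n₃ M₃<n₃ _ →
         outside≡0 (n₁ , n₂ , n₃) (inj₂ (inj₂ M₃<n₃))) ⟩
  (sumTo N₁ λ n₁ → sumTo N₂ λ n₂ → sumTo M₃ λ n₃ → h (n₁ , n₂ , n₃))
    ≡⟨ sumTo-congᶠ N₁ (λ n₁ → sumTo-tail N₂ M₂ _ M₂≤N₂ λ n₂ M₂<n₂ _ → sumTo-zero M₃ λ n₃ _ →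
         outside≡0 (n₁ , n₂ , n₃) (inj₂ (inj₁ M₂<n₂))) ⟩
  (sumTo N₁ λ n₁ → sumTo M₂ λ n₂ → sumTo M₃ λ n₃ → h (n₁ , n₂ , n₃))
    ≡⟨ sumTo-tail N₁ M₁ _ M₁≤N₁ (λ n₁ M₁<n₁ _ → sumTo-zero M₂ λ n₂ _ → sumTo-zero M₃ λ n₃ _ →
         outside≡0 (n₁ , n₂ , n₃) (inj₁ M₁<n₁)) ⟩
  box (M₁ , M₂ , M₃) h ∎

shift³ : ℕ³ → (ℕ³ → ℤ) → ℕ³ → ℤ
shift³ (k₁ , k₂ , k₃) h (n₁ , n₂ , n₃) =
  shiftP k₁ (λ m₁ → shiftP k₂ (λ m₂ → shiftP k₃ (λ m₃ → h (m₁ , m₂ , m₃)) n₃) n₂) n₁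

shift³-above : ∀ κ m (h : ℕ³ → ℤ) → shift³ κ h (κ +³ m) ≡ h m
shift³-above (k₁ , k₂ , k₃) (m₁ , m₂ , m₃) h =
  trans (shiftP-above k₁ m₁ λ x₁ → shiftP k₂ (λ x₂ → shiftP k₃ (λ x₃ → h (x₁ , x₂ , x₃)) (k₃ ℕ.+ m₃)) (k₂ ℕ.+ m₂))
  (trans (shiftP-above k₂ m₂ λ x₂ → shiftP k₃ (λ x₃ → h (m₁ , x₂ , x₃)) (k₃ ℕ.+ m₃))
         (shiftP-above k₃ m₃ λ x₃ → h (m₁ , m₂ , x₃)))

shift³-below : ∀ κ n (h : ℕ³ → ℤ) → κ ≰³ n → shift³ κ h n ≡ 0ℤ
shift³-below (k₁ , k₂ , k₃) (n₁ , n₂ , n₃) h (inj₁ n₁<k₁) =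
  shiftP-below (λ x₁ → shiftP k₂ (λ x₂ → shiftP k₃ (λ x₃ → h (x₁ , x₂ , x₃)) n₃) n₂) n₁<k₁
shift³-below (k₁ , k₂ , k₃) (n₁ , n₂ , n₃) h (inj₂ (inj₁ n₂<k₂)) =
  shiftP-zero k₁ n₁ λ x₁ → shiftP-below (λ x₂ → shiftP k₃ (λ x₃ → h (x₁ , x₂ , x₃)) n₃) n₂<k₂
shift³-below (k₁ , k₂ , k₃) (n₁ , n₂ , n₃) h (inj₂ (inj₂ n₃<k₃)) =
  shiftP-zero k₁ n₁ λ x₁ → shiftP-zero k₂ n₂ λ x₂ → shiftP-below (λ x₃ → h (x₁ , x₂ , x₃)) n₃<k₃

data Cover (κ n : ℕ³) : Set where
  above³ : ∀ m → n ≡ κ +³ m → Cover κ n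
  below³ : κ ≰³ n → Cover κ n

cover : ∀ κ n → Cover κ n
cover (k₁ , k₂ , k₃) (n₁ , n₂ , n₃) with split k₁ n₁ | split k₂ n₂ | split k₃ n₃
... | above m₁ refl | above m₂ refl | above m₃ refl = above³ (m₁ , m₂ , m₃) refl
... | below n₁<k₁   | _             | _             = below³ (inj₁ n₁<k₁)
... | above _ _     | below n₂<k₂   | _             = below³ (inj₂ (inj₁ n₂<k₂))
... | above _ _     | above _ _     | below n₃<k₃   = below³ (inj₂ (inj₂ n₃<k₃))

shiftP-sumTo : ∀ N k (F : ℕ → PS) → (λ n → sumTo N λ i → shiftP k (F i) n) ≗ shiftP k (λ m → sumTo N λ i → F i m)
shiftP-sumTo N k F n with split k n
... | above r refl = trans (sumTo-congᶠ N λ i → shiftP-above k r (F i)) (sym (shiftP-above k r ΣF))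
  where ΣF = λ m → sumTo N λ i → F i m
... | below n<k    = trans (sumTo-zero N λ i _ → shiftP-below (F i) n<k) (sym (shiftP-below ΣF n<k))
  where ΣF = λ m → sumTo N λ i → F i m

box-shift³ : ∀ M κ (h : ℕ³ → ℤ) → box (M +³ κ) (shift³ κ h) ≡ box M h
box-shift³ (M₁ , M₂ , M₃) (k₁ , k₂ , k₃) h = begin
  (sumTo (M₁ ℕ.+ k₁) λ n₁ → sumTo (M₂ ℕ.+ k₂) λ n₂ → sumTo (M₃ ℕ.+ k₃) λ n₃ → shiftP k₁ (λ m₁ → G m₁ n₂ n₃) n₁)
    ≡⟨ sumTo-congᶠ (M₁ ℕ.+ k₁) (λ n₁ → trans
         (sumTo-congᶠ (M₂ ℕ.+ k₂) λ n₂ → shiftP-sumTo (M₃ ℕ.+ k₃) k₁ (λ n₃ m₁ → G m₁ n₂ n₃) n₁)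
         (shiftP-sumTo (M₂ ℕ.+ k₂) k₁ (λ n₂ m₁ → sumTo (M₃ ℕ.+ k₃) λ n₃ → G m₁ n₂ n₃) n₁)) ⟩
  (sumTo (M₁ ℕ.+ k₁) λ n₁ → shiftP k₁ (λ m₁ → sumTo (M₂ ℕ.+ k₂) λ n₂ → sumTo (M₃ ℕ.+ k₃) λ n₃ → G m₁ n₂ n₃) n₁)
    ≡⟨ sumTo-shiftP M₁ k₁ (λ m₁ → sumTo (M₂ ℕ.+ k₂) λ n₂ → sumTo (M₃ ℕ.+ k₃) λ n₃ → G m₁ n₂ n₃) ⟩
  (sumTo M₁ λ m₁ → sumTo (M₂ ℕ.+ k₂) λ n₂ → sumTo (M₃ ℕ.+ k₃) λ n₃ → G m₁ n₂ n₃)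
    ≡⟨ sumTo-congᶠ M₁ (λ m₁ → trans
         (sumTo-congᶠ (M₂ ℕ.+ k₂) λ n₂ → shiftP-sumTo (M₃ ℕ.+ k₃) k₂ (λ n₃ m₂ → H m₁ m₂ n₃) n₂)
         (sumTo-shiftP M₂ k₂ λ m₂ → sumTo (M₃ ℕ.+ k₃) λ n₃ → H m₁ m₂ n₃)) ⟩
  (sumTo M₁ λ m₁ → sumTo M₂ λ m₂ → sumTo (M₃ ℕ.+ k₃) λ n₃ → H m₁ m₂ n₃)
    ≡⟨ sumTo-congᶠ M₁ (λ m₁ → sumTo-congᶠ M₂ λ m₂ → sumTo-shiftP M₃ k₃ λ m₃ → h (m₁ , m₂ , m₃)) ⟩
  box (M₁ , M₂ , M₃) h ∎
  where
  H : ℕ → ℕ → ℕ → ℤ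
  H m₁ m₂ n₃ = shiftP k₃ (λ m₃ → h (m₁ , m₂ , m₃)) n₃
  G : ℕ → ℕ → ℕ → ℤ
  G m₁ n₂ n₃ = shiftP k₂ (λ m₂ → H m₁ m₂ n₃) n₂

weight-+ : ∀ κ m → weight (κ +³ m) ≡ weight κ ℕ.+ weight m
weight-+ (k₁ , k₂ , k₃) (m₁ , m₂ , m₃) = expand k₁ k₂ k₃ m₁ m₂ m₃
  where
  expand : ∀ k₁ k₂ k₃ m₁ m₂ m₃ → k₁ ℕ.+ m₁ ℕ.+ 2 ℕ.* (k₂ ℕ.+ m₂) ℕ.+ 3 ℕ.* (k₃ ℕ.+ m₃)
                               ≡ k₁ ℕ.+ 2 ℕ.* k₂ ℕ.+ 3 ℕ.* k₃ ℕ.+ (m₁ ℕ.+ 2 ℕ.* m₂ ℕ.+ 3 ℕ.* m₃)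
  expand = NS.solve-∀

weight-≥₁ : ∀ n₁ n₂ n₃ → n₁ ≤ weight (n₁ , n₂ , n₃)
weight-≥₁ n₁ n₂ n₃ = ℕP.≤-trans (ℕP.m≤m+n n₁ (2 ℕ.* n₂)) (ℕP.m≤m+n _ (3 ℕ.* n₃))

weight-≥₂ : ∀ n₁ n₂ n₃ → n₂ ≤ weight (n₁ , n₂ , n₃)
weight-≥₂ n₁ n₂ n₃ =
  ℕP.≤-trans (ℕP.≤-trans (ℕP.m≤m+n n₂ (n₂ ℕ.+ 0)) (ℕP.m≤n+m _ n₁)) (ℕP.m≤m+n _ (3 ℕ.* n₃))

weight-≥₃ : ∀ n₁ n₂ n₃ → n₃ ≤ weight (n₁ , n₂ , n₃)
weight-≥₃ n₁ n₂ n₃ = ℕP.≤-trans (ℕP.m≤m+n n₃ (n₃ ℕ.+ (n₃ ℕ.+ 0))) (ℕP.m≤n+m _ (n₁ ℕ.+ 2 ℕ.* n₂))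

weight-> : ∀ {r} n → n ≰³ (r , r , r) → r < weight n
weight-> (n₁ , n₂ , n₃) (inj₁ r<n₁)        = ℕP.<-≤-trans r<n₁ (weight-≥₁ n₁ n₂ n₃)
weight-> (n₁ , n₂ , n₃) (inj₂ (inj₁ r<n₂)) = ℕP.<-≤-trans r<n₂ (weight-≥₂ n₁ n₂ n₃)
weight-> (n₁ , n₂ , n₃) (inj₂ (inj₂ r<n₃)) = ℕP.<-≤-trans r<n₃ (weight-≥₃ n₁ n₂ n₃)

guarded-cong : ∀ w a {x y : ℤ} → (w ≡ a → x ≡ y) → (if w ≡ᵇ a then x else 0ℤ) ≡ (if w ≡ᵇ a then y else 0ℤ)
guarded-cong w a x≡y with w ≡ᵇ a in eq
... | true  = x≡y (ℕP.≡ᵇ⇒≡ w a (Equivalence.from T-≡ eq))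
... | false = refl

simplexSum-cong : ∀ a {h h′ : ℕ³ → ℤ} → (∀ n → weight n ≡ a → h n ≡ h′ n) → simplexSum a h ≡ simplexSum a h′
simplexSum-cong a h≡h′ = box-cong (a , a , a) λ n → guarded-cong (weight n) a (h≡h′ n)

simplexSum-zero : ∀ a {h : ℕ³ → ℤ} → (∀ n → weight n ≡ a → h n ≡ 0ℤ) → simplexSum a h ≡ 0ℤ
simplexSum-zero a h≡0 =
  trans (simplexSum-cong a h≡0) (box-zero (a , a , a) λ n → if-zero (weight n ≡ᵇ a))

simplexSum-+ : ∀ a (h h′ : ℕ³ → ℤ) → simplexSum a h + simplexSum a h′ ≡ simplexSum a (λ n → h n + h′ n)
simplexSum-+ a h h′ =
  trans (sym (box-+ (a , a , a) _ _)) (box-cong (a , a , a) λ n → if-+ (weight n ≡ᵇ a) (h n) (h′ n))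
  where
  if-+ : ∀ t x y → (if t then x else 0ℤ) + (if t then y else 0ℤ) ≡ (if t then x + y else 0ℤ)
  if-+ true  x y = refl
  if-+ false x y = refl

simplexSum-∑ : ∀ {A : Set} a (h : A → ℕ³ → ℤ) ts →
  ∑ (map (λ t → simplexSum a (h t)) ts) ≡ simplexSum a (λ n → ∑ (map (λ t → h t n) ts))
simplexSum-∑ a h []       = sym (simplexSum-zero a λ _ _ → refl)
simplexSum-∑ a h (t ∷ ts) =
  trans (cong (simplexSum a (h t) +_) (simplexSum-∑ a h ts)) (simplexSum-+ a (h t) _)

if-* : ∀ c t (x : ℤ) → c * (if t then x else 0ℤ) ≡ (if t then c * x else 0ℤ)
if-* c true  x = refl
if-* c false x = ℤP.*-zeroʳ c

simplexSum-* : ∀ c a (h : ℕ³ → ℤ) → c * simplexSum a h ≡ simplexSum a (λ n → c * h n)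
simplexSum-* c a h =
  trans (sym (box-* (a , a , a) c _)) (box-cong (a , a , a) λ n → if-* c (weight n ≡ᵇ a) (h n))

shiftP-simplexSum : ∀ s a (h : ℕ³ → PS) →
  shiftP s (λ b → simplexSum a λ n → h n b) ≗ λ b → simplexSum a λ n → shiftP s (h n) b
shiftP-simplexSum s a h b with split s b
... | above r refl = trans (shiftP-above s r (λ b → simplexSum a λ n → h n b))
                           (simplexSum-cong a λ n _ → sym (shiftP-above s r (h n)))
... | below b<s    = trans (shiftP-below (λ b → simplexSum a λ n → h n b) b<s)
                           (sym (simplexSum-zero a λ n _ → shiftP-below (h n) b<s))

simplexSum-shift³ : ∀ κ r (h : ℕ³ → ℤ) → simplexSum (weight κ ℕ.+ r) (shift³ κ h) ≡ simplexSum r h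
simplexSum-shift³ κ@(k₁ , k₂ , k₃) r h = begin
  box (A , A , A) (λ n → if weight n ≡ᵇ A then shift³ κ h n else 0ℤ)
    ≡⟨ box-cong (A , A , A) guard-inside ⟩
  box (A , A , A) (shift³ κ g)
    ≡⟨ box-shrink (shift³ κ g) (bound (weight-≥₁ k₁ k₂ k₃)) (bound (weight-≥₂ k₁ k₂ k₃)) (bound (weight-≥₃ k₁ k₂ k₃))
                  outside ⟩
  box ((r , r , r) +³ κ) (shift³ κ g)
    ≡⟨ box-shift³ (r , r , r) κ g ⟩
  simplexSum r h ∎
  where
  A = weight κ ℕ.+ r
  g : ℕ³ → ℤ
  g m = if weight m ≡ᵇ r then h m else 0ℤ
  guard-inside : (λ n → if weight n ≡ᵇ A then shift³ κ h n else 0ℤ) ≗ shift³ κ g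
  guard-inside n with cover κ n
  ... | above³ m refl = begin
    (if weight (κ +³ m) ≡ᵇ A then shift³ κ h (κ +³ m) else 0ℤ)
      ≡⟨ cong₂ (λ t x → if t then x else 0ℤ)
               (trans (cong (_≡ᵇ A) (weight-+ κ m)) (≡ᵇ-+ (weight κ) (weight m) r)) (shift³-above κ m h) ⟩
    g m                 ≡⟨ shift³-above κ m g ⟨
    shift³ κ g (κ +³ m) ∎
  ... | below³ κ≰n = trans (cong (λ x → if weight n ≡ᵇ A then x else 0ℤ) (shift³-below κ n h κ≰n))
                           (trans (if-zero (weight n ≡ᵇ A)) (sym (shift³-below κ n g κ≰n)))
  bound : ∀ {k} → k ≤ weight κ → r ℕ.+ k ≤ A
  bound k≤w = ℕP.≤-trans (ℕP.+-monoʳ-≤ r k≤w) (ℕP.≤-reflexive (ℕP.+-comm r (weight κ)))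
  outside : ∀ n → n ≰³ ((r , r , r) +³ κ) → shift³ κ g n ≡ 0ℤ
  outside n n≰ with cover κ n
  ... | below³ κ≰n = shift³-below κ n g κ≰n
  ... | above³ m refl = trans (shift³-above κ m g) (cong (if_then h m else 0ℤ) (≡ᵇ-> (weight m) r (weight-> m m≰r)))
    where
    drop : ∀ {k m} → r ℕ.+ k < k ℕ.+ m → r < m
    drop {k} {m} lt = ℕP.+-cancelˡ-< k r m (ℕP.≤-trans (s≤s (ℕP.≤-reflexive (ℕP.+-comm k r))) lt)
    m≰r : m ≰³ (r , r , r)
    m≰r = ⊎-map drop (⊎-map drop drop) n≰

T-as-shift : ∀ c i j k a b → T c i j k a b ≡ (if i ≤ᵇ a then c * shiftP (k ℕ.* (a ∸ i) ℕ.+ j) (S (a ∸ i)) b else 0ℤ)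
T-as-shift c i j k a b with i ≤ᵇ a
... | false = refl
... | true  = trans (shiftP-map j (c *_) (ℤP.*-zeroʳ c) (shiftP u (S (a ∸ i))) b)
                    (cong (c *_) (shiftP-shiftP j u (S (a ∸ i)) b))
  where u = k ℕ.* (a ∸ i)

T-simplex : ∀ c j k κ a b → T c (weight κ) j k a b
  ≡ simplexSum a (shift³ κ λ m → c * shiftP (k ℕ.* (a ∸ weight κ) ℕ.+ j) (term³ m) b)
T-simplex c j k κ a b with split (weight κ) a
... | above r refl = begin
  T c w j k (w ℕ.+ r) b
    ≡⟨ T-as-shift c w j k (w ℕ.+ r) b ⟩
  (if w ≤ᵇ w ℕ.+ r then c * shiftP (k ℕ.* (w ℕ.+ r ∸ w) ℕ.+ j) (S (w ℕ.+ r ∸ w)) b else 0ℤ)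
    ≡⟨ cong (if_then c * shiftP s (S (w ℕ.+ r ∸ w)) b else 0ℤ) (≤ᵇ-+ w r) ⟩
  c * shiftP s (S (w ℕ.+ r ∸ w)) b
    ≡⟨ cong (λ t → c * shiftP s (S t) b) (ℕP.m+n∸m≡n w r) ⟩
  c * shiftP s (S r) b
    ≡⟨ cong (c *_) (shiftP-simplexSum s r term³ b) ⟩
  c * simplexSum r (λ m → shiftP s (term³ m) b)
    ≡⟨ simplexSum-* c r (λ m → shiftP s (term³ m) b) ⟩
  simplexSum r (λ m → c * shiftP s (term³ m) b)
    ≡⟨ simplexSum-shift³ κ r (λ m → c * shiftP s (term³ m) b) ⟨
  simplexSum (w ℕ.+ r) (shift³ κ λ m → c * shiftP s (term³ m) b) ∎
  where
  w = weight κ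
  s = k ℕ.* (w ℕ.+ r ∸ w) ℕ.+ j
... | below a<w = begin
  T c (weight κ) j k a b
    ≡⟨ T-as-shift c (weight κ) j k a b ⟩
  (if weight κ ≤ᵇ a then c * shiftP s (S (a ∸ weight κ)) b else 0ℤ)
    ≡⟨ cong (if_then c * shiftP s (S (a ∸ weight κ)) b else 0ℤ) (≤ᵇ-< a<w) ⟩
  0ℤ
    ≡⟨ simplexSum-zero a unreachable ⟨
  simplexSum a (shift³ κ H) ∎
  where
  s = k ℕ.* (a ∸ weight κ) ℕ.+ j
  H : ℕ³ → ℤ
  H m = c * shiftP s (term³ m) b
  unreachable : ∀ n → weight n ≡ a → shift³ κ H n ≡ 0ℤ
  unreachable n wn≡a with cover κ n
  ... | below³ κ≰n = shift³-below κ n H κ≰n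
  ... | above³ m refl = ⊥-elim (ℕP.<⇒≱ a<w (ℕP.≤-trans (ℕP.m≤m+n (weight κ) (weight m))
                                                       (ℕP.≤-reflexive (trans (sym (weight-+ κ m)) wn≡a))))

σ : ℕ → ℤ
σ n = -1ℤ ℤ.^ n

σ-square : ∀ k → σ k * σ k ≡ 1ℤ
σ-square zero    = refl
σ-square (suc k) = trans (flip (σ k)) (σ-square k)
  where
  flip : ∀ x → -1ℤ * x * (-1ℤ * x) ≡ x * x
  flip = solve-∀

sign : ℕ³ → ℤ
sign (_ , _ , n₃) = σ n₃

unsignedTerm : ℕ³ → PS
unsignedTerm n = shiftP (expo³ n) (invPoch³ n)

-- c x^i q^j S(x q^k) contributes sign n · (multiplier · unsignedTerm n) at the simplex point n.
multiplier : ℤ → ℕ³ → Exp → Poly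
multiplier c κ@(_ , _ , k₃) f = ((c * σ k₃ , f) ∷ []) ·ᴾ falls κ

⟦multiplier⟧ : ∀ c (κ : ℕ³) f n → let (_ , _ , k₃) = κ in ⟦ multiplier c κ f ⟧ n (unsignedTerm n)
  ≗ λ b → c * σ k₃ * shiftP (expo³ n ℕ.+ ev f n) (⟦ falls κ ⟧ n (invPoch³ n)) b
⟦multiplier⟧ c κ@(_ , _ , k₃) f n b = begin
  ⟦ multiplier c κ f ⟧ n (unsignedTerm n) b
    ≡⟨ ⟦⟧-·ᴾ n ((c * σ k₃ , f) ∷ []) (falls κ) (unsignedTerm n) b ⟩
  c * σ k₃ * shiftP (ev f n) (⟦ falls κ ⟧ n (unsignedTerm n)) b + 0ℤ
    ≡⟨ ℤP.+-identityʳ _ ⟩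
  c * σ k₃ * shiftP (ev f n) (⟦ falls κ ⟧ n (shiftP (expo³ n) (invPoch³ n))) b
    ≡⟨ cong (c * σ k₃ *_) (shiftP-cong (ev f n) (λ b → sym (shiftP-⟦⟧ n (expo³ n) (falls κ) (invPoch³ n) b)) b) ⟩
  c * σ k₃ * shiftP (ev f n) (shiftP (expo³ n) (⟦ falls κ ⟧ n (invPoch³ n))) b
    ≡⟨ cong (c * σ k₃ *_) (shiftP-shiftP (ev f n) (expo³ n) (⟦ falls κ ⟧ n (invPoch³ n)) b) ⟩
  c * σ k₃ * shiftP (expo³ n ℕ.+ ev f n) (⟦ falls κ ⟧ n (invPoch³ n)) b ∎

⟦multiplier⟧-vanishes : ∀ c κ f n → κ ≰³ n → ∀ (g : PS) → ⟦ multiplier c κ f ⟧ n g ≗ λ _ → 0ℤ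
⟦multiplier⟧-vanishes c κ@(_ , _ , k₃) f n κ≰n g b =
  trans (⟦⟧-·ᴾ n M₀ (falls κ) g b) (⟦⟧-zero n M₀ (⟦falls⟧-vanishes κ n κ≰n g) b)
  where
  M₀ = (c * σ k₃ , f) ∷ []

unsignedTerm-recentred : ∀ j k κ f → Balanced j k κ f → ∀ m → let n = κ +³ m in
  shiftP (k ℕ.* weight m ℕ.+ j) (unsignedTerm m) ≗ shiftP (expo³ n ℕ.+ ev f n) (⟦ falls κ ⟧ n (invPoch³ n))
unsignedTerm-recentred j k κ f balanced m b = begin
  shiftP s (shiftP (expo³ m) (invPoch³ m)) b
    ≡⟨ shiftP-shiftP s (expo³ m) (invPoch³ m) b ⟩
  shiftP (expo³ m ℕ.+ s) (invPoch³ m) b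
    ≡⟨ cong (λ e → shiftP e (invPoch³ m) b) (exponent-match j k κ f balanced m) ⟩
  shiftP (fallExp κ ℕ.+ t) (invPoch³ m) b
    ≡⟨ shiftP-shiftP t (fallExp κ) (invPoch³ m) b ⟨
  shiftP t (shiftP (fallExp κ) (invPoch³ m)) b
    ≡⟨ shiftP-cong t (invPoch³-falls κ m) b ⟩
  shiftP t (⟦ falls κ ⟧ (κ +³ m) (invPoch³ (κ +³ m))) b ∎
  where
  s = k ℕ.* weight m ℕ.+ j
  t = expo³ (κ +³ m) ℕ.+ ev f (κ +³ m)

contribution-at : ∀ c j k κ f → Balanced j k κ f → ∀ b n →
  shift³ κ (λ m → c * shiftP (k ℕ.* (weight n ∸ weight κ) ℕ.+ j) (term³ m) b) n
  ≡ sign n * ⟦ multiplier c κ f ⟧ n (unsignedTerm n) b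
contribution-at c j k κ f balanced b n with cover κ n
... | below³ κ≰n = begin
  shift³ κ H n
    ≡⟨ shift³-below κ n H κ≰n ⟩
  0ℤ
    ≡⟨ ℤP.*-zeroʳ (sign n) ⟨
  sign n * 0ℤ
    ≡⟨ cong (sign n *_) (⟦multiplier⟧-vanishes c κ f n κ≰n (unsignedTerm n) b) ⟨
  sign n * ⟦ multiplier c κ f ⟧ n (unsignedTerm n) b ∎
  where
  H = λ x → c * shiftP (k ℕ.* (weight n ∸ weight κ) ℕ.+ j) (term³ x) b
contribution-at c j k κ@(k₁ , k₂ , k₃) f balanced b _ | above³ m@(m₁ , m₂ , m₃) refl = begin
  shift³ κ H (κ +³ m)
    ≡⟨ shift³-above κ m H ⟩
  c * shiftP (k ℕ.* (weight (κ +³ m) ∸ weight κ) ℕ.+ j) (term³ m) b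
    ≡⟨ cong (λ w → c * shiftP (k ℕ.* w ℕ.+ j) (term³ m) b)
            (trans (cong (_∸ weight κ) (weight-+ κ m)) (ℕP.m+n∸m≡n (weight κ) (weight m))) ⟩
  c * shiftP s (term³ m) b
    ≡⟨ cong (c *_) (shiftP-map s (σ m₃ *_) (ℤP.*-zeroʳ (σ m₃)) (unsignedTerm m) b) ⟩
  c * (σ m₃ * shiftP s (unsignedTerm m) b)
    ≡⟨ cong (λ x → c * (σ m₃ * x)) (unsignedTerm-recentred j k κ f balanced m b) ⟩
  c * (σ m₃ * Z)
    ≡⟨ resign ⟩
  σ (k₃ ℕ.+ m₃) * (c * σ k₃ * Z)
    ≡⟨ cong (σ (k₃ ℕ.+ m₃) *_) (⟦multiplier⟧ c κ f (κ +³ m) b) ⟨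
  σ (k₃ ℕ.+ m₃) * ⟦ multiplier c κ f ⟧ (κ +³ m) (unsignedTerm (κ +³ m)) b ∎
  where
  H = λ x → c * shiftP (k ℕ.* (weight (κ +³ m) ∸ weight κ) ℕ.+ j) (term³ x) b
  s = k ℕ.* weight m ℕ.+ j
  Z = shiftP (expo³ (κ +³ m) ℕ.+ ev f (κ +³ m)) (⟦ falls κ ⟧ (κ +³ m) (invPoch³ (κ +³ m))) b
  resign : c * (σ m₃ * Z) ≡ σ (k₃ ℕ.+ m₃) * (c * σ k₃ * Z)
  resign = sym (begin
    σ (k₃ ℕ.+ m₃) * (c * σ k₃ * Z)   ≡⟨ cong (_* (c * σ k₃ * Z)) (ℤP.^-distribˡ-+-* -1ℤ k₃ m₃) ⟩
    σ k₃ * σ m₃ * (c * σ k₃ * Z)     ≡⟨ regroup (σ k₃) (σ m₃) c Z ⟩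
    σ k₃ * σ k₃ * (c * (σ m₃ * Z))   ≡⟨ cong (_* (c * (σ m₃ * Z))) (σ-square k₃) ⟩
    1ℤ * (c * (σ m₃ * Z))            ≡⟨ ℤP.*-identityˡ (c * (σ m₃ * Z)) ⟩
    c * (σ m₃ * Z)                   ∎)
    where
    regroup : ∀ s t c x → s * t * (c * s * x) ≡ s * s * (c * (t * x))
    regroup = solve-∀

term-contribution : ∀ c j k κ f → Balanced j k κ f → ∀ a b →
  T c (weight κ) j k a b ≡ simplexSum a (λ n → sign n * ⟦ multiplier c κ f ⟧ n (unsignedTerm n) b)
term-contribution c j k κ f balanced a b =
  trans (T-simplex c j k κ a b) (simplexSum-cong a λ n weight≡a →
    trans (cong (λ w → shift³ κ (λ m → c * shiftP (k ℕ.* (w ∸ weight κ) ℕ.+ j) (term³ m) b) n) (sym weight≡a))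
          (contribution-at c j k κ f balanced b n))

-- The functional equation

-- coeff · x^(weight shift) q^qExp S(x q^dilation), together with the data pairing its
-- summands with those of S(x).
record Summand : Set where
  constructor summand
  field
    coeff          : ℤ
    qExp dilation  : ℕ
    shift          : ℕ³
    offset         : Exp
    balanced       : Balanced qExp dilation shift offset

open Summand

contribution : Summand → ℕ → ℕ → ℤ
contribution t = T (coeff t) (weight (shift t)) (qExp t) (dilation t)

multiplierOf : Summand → Poly
multiplierOf t = multiplier (coeff t) (shift t) (offset t)

localContribution : Summand → ℕ³ → ℕ → ℤ
localContribution t n b = sign n * ⟦ multiplierOf t ⟧ n (unsignedTerm n) b

contribution-simplex : ∀ t a b → contribution t a b ≡ simplexSum a (λ n → localContribution t n b)
contribution-simplex t = term-contribution (coeff t) (qExp t) (dilation t) (shift t) (offset t) (balanced t)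

summands : List Summand
summands =
    summand  1ℤ  0  0 (0 , 0 , 0) (0 , 0 , 0 , 0) refl
  ∷ summand -1ℤ  2  2 (0 , 1 , 0) (0 , 0 , 0 , 0) refl
  ∷ summand -1ℤ  4  2 (0 , 1 , 0) (2 , 0 , 0 , 0) refl
  ∷ summand -1ℤ  6  2 (0 , 1 , 0) (4 , 0 , 0 , 0) refl
  ∷ summand -1ℤ  0  2 (0 , 0 , 0) (0 , 2 , 4 , 6) refl
  ∷ summand  1ℤ 10  4 (0 , 2 , 0) (0 , 0 , 0 , 0) refl
  ∷ summand  1ℤ 12  4 (0 , 2 , 0) (2 , 0 , 0 , 0) refl
  ∷ summand  1ℤ 14  4 (0 , 2 , 0) (4 , 0 , 0 , 0) refl
  ∷ summand  1ℤ  6  4 (0 , 1 , 0) (0 , 2 , 4 , 6) refl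
  ∷ summand -1ℤ  1  4 (1 , 0 , 0) (0 , 0 , 6 , 6) refl
  ∷ summand -1ℤ 24  6 (0 , 3 , 0) (0 , 0 , 0 , 0) refl
  ∷ summand  1ℤ  9  6 (0 , 0 , 1) (0 , 0 , 6 , 0) refl
  ∷ []

-- The multipliers sum to zero in ℤ[q, q^(2n₁), q^(2n₂), q^(6n₃)].
multipliers-cancel : normalise (concatMap multiplierOf summands) ≡ []
multipliers-cancel = refl

R-as-sum : ∀ a b → R a b ≡ ∑ (map (λ t → contribution t a b) summands)
R-as-sum a b = reassociate
  (τ 1ℤ 0 0 0) (τ -1ℤ 2 2 2) (τ -1ℤ 2 4 2) (τ -1ℤ 2 6 2) (τ -1ℤ 0 0 2) (τ 1ℤ 4 10 4)
  (τ 1ℤ 4 12 4) (τ 1ℤ 4 14 4) (τ 1ℤ 2 6 4) (τ -1ℤ 1 1 4) (τ -1ℤ 6 24 6) (τ 1ℤ 3 9 6)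
  where
  τ : ℤ → ℕ → ℕ → ℕ → ℤ
  τ c i j k = T c i j k a b
  reassociate : ∀ x₁ x₂ x₃ x₄ x₅ x₆ x₇ x₈ x₉ x₁₀ x₁₁ x₁₂ →
    x₁ + x₂ + x₃ + x₄ + x₅ + x₆ + x₇ + x₈ + x₉ + x₁₀ + x₁₁ + x₁₂
    ≡ x₁ + (x₂ + (x₃ + (x₄ + (x₅ + (x₆ + (x₇ + (x₈ + (x₉ + (x₁₀ + (x₁₁ + (x₁₂ + 0ℤ)))))))))))
  reassociate = solve-∀

localContributions-cancel : ∀ n b → ∑ (map (λ t → localContribution t n b) summands) ≡ 0ℤ
localContributions-cancel n b = begin
  ∑ (map (λ t → sign n * ⟦ multiplierOf t ⟧ n (unsignedTerm n) b) summands)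
    ≡⟨ ∑-⟦⟧ (sign n) n multiplierOf (unsignedTerm n) b summands ⟩
  sign n * ⟦ concatMap multiplierOf summands ⟧ n (unsignedTerm n) b
    ≡⟨ cong (sign n *_) (⟦⟧-normalise n (concatMap multiplierOf summands) (unsignedTerm n) b) ⟨
  sign n * ⟦ normalise (concatMap multiplierOf summands) ⟧ n (unsignedTerm n) b
    ≡⟨ cong (λ p → sign n * ⟦ p ⟧ n (unsignedTerm n) b) multipliers-cancel ⟩
  sign n * 0ℤ
    ≡⟨ ℤP.*-zeroʳ (sign n) ⟩
  0ℤ ∎

mainTheorem9 : (a b : ℕ) → R a b ≡ 0ℤ
mainTheorem9 a b = begin
  R a b
    ≡⟨ R-as-sum a b ⟩
  ∑ (map (λ t → contribution t a b) summands)
    ≡⟨ cong ∑ (map-cong (λ t → contribution-simplex t a b) summands) ⟩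
  ∑ (map (λ t → simplexSum a (λ n → localContribution t n b)) summands)
    ≡⟨ simplexSum-∑ a (λ t n → localContribution t n b) summands ⟩
  simplexSum a (λ n → ∑ (map (λ t → localContribution t n b) summands))
    ≡⟨ simplexSum-zero a (λ n _ → localContributions-cancel n b) ⟩
  0ℤ ∎
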